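{- For every integer $k\ge 1$, \[ n(d_{(k,k)},d_{(k,k)}) = (2k)! - 2\Big(k!\,k! + \sum_{\substack{1\le i\le k-1\\ 1\le j\le k-1}} i!\,j!\,c_{2k-i-j} + 2\sum_{i=1}^{k-1} i!\,c_{2k-i}\Big). \]
   Context: A rooted tree is a finite tree with a distinguished vertex (the root); its leaves are the non-root vertices of degree $1$, and an internal edge is an edge not incident to a leaf. Given rooted trees $t_1,t_2$ with the same number of leaves, a gluing is a bijection $\sigma$ from the leaves of $t_1$ to the leaves of $t_2$; its associated graph is obtained from the disjoint union of $t_1$ and $t_2$ by identifying each leaf $u$ of $t_1$ with $\sigma(u)$ and then suppressing each resulting 2-valent vertex, so that each glued pair becomes a single edge joining the parent of $u$ to the parent of $\sigma(u)$. The gluing has a subdivergence if there exist an internal edge $e_1$ of $t_1$ and an internal edge $e_2$ of $t_2$ such that $\{e_1,e_2\}$ is a 2-edge cut of this graph and one of the two resulting components contains neither root. $n(t_1,t_2)$ is the number of gluings (bijections) with no subdivergence. $\ell_m$ is the rooted tree with $m$ internal vertices forming a path with the root at one end and exactly one leaf attached to each internal vertex. $d_{(i,j)}$ is the rooted tree consisting of a new root vertex whose two children are the roots of a copy of $\ell_i$ and a copy of $\ell_j$. $c_m$ is the number of permutations $\sigma$ of $\{1,\dots,m\}$ with $\sigma(\{1,\dots,r\})\ne\{1,\dots,r\}$ for all $r\in\{1,\dots,m-1\}$. Empty sums are $0$. -}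

module Defs where

open import Data.Nat using (ℕ; zero; suc; _+_; _*_; _<_; _≤_; _≤?_; _<?_; _!)
open import Data.Fin using (Fin; zero; suc; toℕ; inject₁; splitAt)
open import Data.Fin.Properties using (all?; any?) renaming (_≟_ to _≟F_)
open import Data.Vec using (Vec; []; _∷_; lookup)
open import Data.List using (List; []; _∷_; length; map; concatMap; filter; upTo; allFin; [_])
open import Data.Nat.ListAction using (sum)
open import Data.List.Membership.Propositional using (_∈_)
open import Data.List.Relation.Unary.Unique.Propositional using (Unique)
open import Data.Bool using (Bool; true; false)
open import Data.Unit using (⊤; tt)
open import Data.Sum using (_⊎_; inj₁; inj₂) renaming ([_,_] to either)
open import Data.Product using (Σ; ∃; _×_; _,_)
open import Relation.Nullary using (¬_; Dec)
open import Relation.Nullary.Decidable using (_×-dec_; _→-dec_; ¬?)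
open import Relation.Binary.PropositionalEquality using (_≡_; _≢_)

IsBij : {m n : ℕ} → (Fin m → Fin n) → Set
IsBij {m} {n} f = ((i j : Fin m) → f i ≡ f j → i ≡ j) × ((y : Fin n) → ∃ λ x → f x ≡ y)

-- Rooted trees, presented through their internal (non-leaf) vertices,
-- their internal edges (edges not incident to a leaf) and, for each of
-- the `leaves` leaves (labelled by Fin leaves), the vertex it hangs from.
-- The full tree is: vertices IV ⊎ Fin leaves, edges IE ⊎ {parent u — u}.

record RTree : Set₁ where
  field
    IV     : Set
    root   : IV
    IE     : Set
    ends   : IE → IV × IV
    leaves : ℕ
    parent : Fin leaves → IV
open RTree public

-- d₊ a b  is the tree d_(a+1, b+1): a root whose two children are the roots
-- of a copy of ℓ_(a+1) (spine vertices Fin (suc a), vertex zero = root of ℓ,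
-- spine edge p joins p and p+1, leaf attached to every spine vertex)
-- and a copy of ℓ_(b+1).
d₊ : ℕ → ℕ → RTree
d₊ a b = record
  { IV     = ⊤ ⊎ (Fin (suc a) ⊎ Fin (suc b))
  ; root   = inj₁ tt
  ; IE     = Bool ⊎ (Fin a ⊎ Fin b)
  ; ends   = e
  ; leaves = suc a + suc b
  ; parent = λ u → either (λ x → inj₂ (inj₁ x)) (λ y → inj₂ (inj₂ y)) (splitAt (suc a) u)
  }
  where
  e : Bool ⊎ (Fin a ⊎ Fin b) → (⊤ ⊎ (Fin (suc a) ⊎ Fin (suc b))) × (⊤ ⊎ (Fin (suc a) ⊎ Fin (suc b)))
  e (inj₁ true)         = inj₁ tt , inj₂ (inj₁ zero)
  e (inj₁ false)        = inj₁ tt , inj₂ (inj₂ zero)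
  e (inj₂ (inj₁ p))     = inj₂ (inj₁ (inject₁ p)) , inj₂ (inj₁ (suc p))
  e (inj₂ (inj₂ p))     = inj₂ (inj₂ (inject₁ p)) , inj₂ (inj₂ (suc p))

-- Vertices: internal vertices of t₁ and t₂; edges: internal edges of
-- t₁ and t₂, and for each leaf u of t₁ the edge parent(u) — parent(σ u).

module Gluing (t₁ t₂ : RTree) (σ : Fin (leaves t₁) → Fin (leaves t₂)) where

  V : Set
  V = IV t₁ ⊎ IV t₂

  E : Set
  E = IE t₁ ⊎ (IE t₂ ⊎ Fin (leaves t₁))

  endpoints : E → V × V
  endpoints (inj₁ x) with ends t₁ x
  ... | u , w = inj₁ u , inj₁ w
  endpoints (inj₂ (inj₁ x)) with ends t₂ x
  ... | u , w = inj₂ u , inj₂ w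
  endpoints (inj₂ (inj₂ u)) = inj₁ (parent t₁ u) , inj₂ (parent t₂ (σ u))

  data Conn (ok : E → Set) : V → V → Set where
    here : ∀ {v} → Conn ok v v
    step : ∀ {u w x} (e : E) → ok e →
           (endpoints e ≡ (u , w)) ⊎ (endpoints e ≡ (w , u)) →
           Conn ok w x → Conn ok u x

  r₁ r₂ : V
  r₁ = inj₁ (root t₁)
  r₂ = inj₂ (root t₂)

  -- {e₁,e₂} is a 2-edge cut whose removal leaves exactly two components,
  -- one of which (that of v) contains neither root.
  Subdivergence : Set
  Subdivergence =
    Σ (IE t₁) λ e₁ → Σ (IE t₂) λ e₂ →
      let ok : E → Set
          ok e = (e ≢ inj₁ e₁) × (e ≢ inj₂ (inj₁ e₂))
      in Σ V λ v →
           Conn ok r₁ r₂ × ¬ Conn ok r₁ v × ¬ Conn ok r₂ v ×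
           ((w : V) → Conn ok r₁ w ⊎ Conn ok v w)

-- NoSubdivCount t₁ t₂ N  expresses  n(t₁,t₂) = N : there is a duplicate-free
-- list, of length N, of exactly the gluings (bijections, as lookup tables)
-- that have no subdivergence.
NoSubdivCount : RTree → RTree → ℕ → Set
NoSubdivCount t₁ t₂ N =
  Σ (List (Vec (Fin (leaves t₂)) (leaves t₁))) λ L →
    Unique L ×
    ((v : Vec (Fin (leaves t₂)) (leaves t₁)) →
       (v ∈ L → IsBij (lookup v) × ¬ Gluing.Subdivergence t₁ t₂ (lookup v)) ×
       (IsBij (lookup v) × ¬ Gluing.Subdivergence t₁ t₂ (lookup v) → v ∈ L)) ×
    length L ≡ N

-- c_m (0-indexed: permutations of Fin m, {1..r} becomes {0..r-1})

allVecs : (m n : ℕ) → List (Vec (Fin m) n)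
allVecs m zero    = [ [] ]
allVecs m (suc n) = concatMap (λ x → map (x ∷_) (allVecs m n)) (allFin m)

ImageIs : {m : ℕ} → (Fin m → Fin m) → ℕ → Set
ImageIs {m} f r = (y : Fin m) →
  (toℕ y < r → ∃ λ i → toℕ i < r × f i ≡ y) × ((∃ λ i → toℕ i < r × f i ≡ y) → toℕ y < r)

IsC : (m : ℕ) → Vec (Fin m) m → Set
IsC m v = IsBij (lookup v) × ((r : Fin m) → 1 ≤ toℕ r → ¬ ImageIs (lookup v) (toℕ r))

IsBij? : {m n : ℕ} (f : Fin m → Fin n) → Dec (IsBij f)
IsBij? f = all? (λ i → all? (λ j → (f i ≟F f j) →-dec (i ≟F j)))
           ×-dec all? (λ y → any? (λ x → f x ≟F y))

ImageIs? : {m : ℕ} (f : Fin m → Fin m) (r : ℕ) → Dec (ImageIs f r)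
ImageIs? f r = all? λ y →
  ((toℕ y <? r) →-dec any? (λ i → (toℕ i <? r) ×-dec (f i ≟F y)))
  ×-dec (any? (λ i → (toℕ i <? r) ×-dec (f i ≟F y)) →-dec (toℕ y <? r))

IsC? : (m : ℕ) (v : Vec (Fin m) m) → Dec (IsC m v)
IsC? m v = IsBij? (lookup v) ×-dec all? (λ r → (1 ≤? toℕ r) →-dec ¬? (ImageIs? (lookup v) (toℕ r)))

c : ℕ → ℕ
c m = length (filter (IsC? m) (allVecs m m))

range1 : ℕ → List ℕ
range1 n = map suc (upTo n)

sum1to : ℕ → (ℕ → ℕ) → ℕ
sum1to n f = sum (map f (range1 n))

{-# OPTIONS --safe #-}
-- Number the 2k leaves of d(k,k) by positions 0, …, 2k - 1: first the leaves of the left arm from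
-- the bottom up, then those of the right arm from the top down. The leaves below an internal edge
-- then occupy a prefix [0, s) with 1 ≤ s ≤ k or a suffix [r, 2k) with k ≤ r < 2k, and a gluing has a
-- subdivergence exactly when, read in positions on both sides, it is a permutation π that maps the
-- leaves below one edge onto the leaves below another. As complements of prefixes are suffixes,
-- this happens iff π or its complement i ↦ 2k - 1 - π(i) maps a proper prefix onto itself, i.e. π is
-- decomposable or skew-decomposable. No permutation is both and complementing swaps the two
-- classes, so n(d,d) = (2k)! - 2D with D the number of decomposable permutations of 2k points.
-- A permutation is decomposable or counted by c, so D = (2k)! - c_{2k}. Cutting a permutation at its
-- last proper stable prefix gives Σ_{j<M} j! c_{M-j} = M!, and rearranging this recurrence shows that
-- the bracket in the theorem is (2k)! - c_{2k} as well.
module Submission where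

open import Defs
open import Data.Nat using (ℕ; zero; suc; s≤s⁻¹; _+_; _*_; _∸_; _≤_; _<_; _≤?_; _<?_; _!; z≤n; s≤s)
open import Data.Nat.Tactic.RingSolver using (solve-∀)
open import Data.Nat.Properties
  using (≤-antisym; ≤-refl; <-irrefl; <-≤-trans; <⇒≤; <⇒≱; m≤m+n; +-monoʳ-<; +-monoʳ-≤; +-cancelˡ-<; +-cancelˡ-≤;
         m+[n∸m]≡n; ≤-<-connex; +-comm; <-cmp; <-trans; ≤-pred; m≤n⇒m≤1+n; m≤n⇒m<n∨m≡n; suc-injective;
         ≤-trans; +-assoc; +-suc; +-identityʳ; *-assoc; *-zeroʳ; *-distribˡ-+; n∸n≡0; +-∸-assoc; ∸-+-assoc;
         [m+n]∸[m+o]≡n∸o; m<n⇒0<n∸m; ≤-total; ≮⇒≥; ≰⇒>; n≤0⇒n≡0; ≤∧≢⇒<; ∸-monoʳ-<; ∸-monoʳ-≤; ∸-cancelʳ-<; ≤-<-trans; m<m+n; +-mono-≤; *-identityˡ; *-comm; m+n∸m≡n; m∸n≤m; m∸[m∸n]≡n; +-cancelʳ-≡; *-identityʳ)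
open import Data.Fin using (Fin; zero; suc; toℕ; opposite; inject≤; inject₁; punchIn; punchOut; splitAt; _↑ˡ_; _↑ʳ_; fromℕ<)
open import Data.Fin.Properties
  using (injective⇒≤; all?; any?; toℕ-inject₁; toℕ-inject≤; toℕ-injective; fromℕ<-injective; opposite-prop; opposite-involutive; toℕ<n; toℕ-fromℕ<; toℕ-↑ˡ; toℕ-↑ʳ; ↑ˡ-injective; ↑ʳ-injective; splitAt⁻¹-↑ˡ; splitAt⁻¹-↑ʳ; splitAt-↑ˡ; splitAt-↑ʳ; punchIn-injective; punchInᵢ≢i; punchOut-injective; punchIn-punchOut; punchOut-punchIn; punchOut-cong)
  renaming (_≟_ to _≟ꟳ_)
open import Data.List using (List; []; _∷_; length; map; concatMap; filter; _++_; allFin; applyUpTo; cartesianProductWith)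
open import Data.Nat.ListAction using (sum)
import Data.List as List
open import Data.List.Properties using (length-map; length-++; length-tabulate)
open import Data.List.Membership.Propositional using (_∈_)
open import Data.List.Membership.Propositional.Properties
  using (∈-++⁺ˡ; ∈-++⁺ʳ; ∈-++⁻; ∈-filter⁺; ∈-filter⁻; ∈-lookup; ∈-allFin; ∈-cartesianProductWith⁺; ∈-cartesianProductWith⁻)
open import Data.List.Membership.Setoid.Properties using (index-injective)
open import Data.List.Relation.Unary.Any using (here; index)
import Data.List.Relation.Unary.All as All
open import Data.List.Relation.Unary.AllPairs using ([]; _∷_)
open import Data.List.Relation.Unary.Unique.Propositional using (Unique)
import Data.List.Relation.Unary.Unique.Propositional.Properties as Unique
open import Data.Vec using (Vec; []; _∷_; lookup; tabulate) renaming (map to mapᵥ; _++_ to _++ᵥ_)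
open import Data.Vec.Properties using (∷-injective; lookup-map; lookup∘tabulate; tabulate∘lookup; tabulate-cong; lookup-++ˡ; lookup-++ʳ)
open import Function using (_∘_)
open import Data.Product using (Σ; ∃; _×_; _,_; proj₁; proj₂)
open import Data.Sum using (_⊎_; inj₁; inj₂; [_,_]′)
import Data.Sum
open import Data.Empty using (⊥; ⊥-elim)
open import Data.Unit using (⊤; tt)
open import Data.Bool using (Bool; true; false)
open import Level using (0ℓ)
open import Relation.Unary using (Pred; Decidable; U; _⊆_; _≐_; _∪_; _∩_; _⟨×⟩_)
open import Relation.Nullary using (¬_; Dec; yes; no)
open import Relation.Binary.Definitions using (tri<; tri≈; tri>)
open import Relation.Nullary.Decidable using (_×-dec_; _→-dec_; ¬?)
open import Relation.Binary.PropositionalEquality using (_≡_; _≢_; refl; sym; trans; cong; cong₂; subst; setoid; module ≡-Reasoning)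
open ≡-Reasoning

Σ< : ℕ → (ℕ → ℕ) → ℕ
Σ< zero f = 0
Σ< (suc B) f = Σ< B f + f B

Σ<-cong : (B : ℕ) {f h : ℕ → ℕ} → (∀ i → i < B → f i ≡ h i) → Σ< B f ≡ Σ< B h
Σ<-cong zero _ = refl
Σ<-cong (suc B) f≡h = cong₂ _+_ (Σ<-cong B λ i i<B → f≡h i (m≤n⇒m≤1+n i<B)) (f≡h B ≤-refl)

Σ<-+ : (B : ℕ) (f h : ℕ → ℕ) → Σ< B (λ i → f i + h i) ≡ Σ< B f + Σ< B h
Σ<-+ zero f h = refl
Σ<-+ (suc B) f h = trans (cong (_+ (f B + h B)) (Σ<-+ B f h)) (+-interchange (Σ< B f) (Σ< B h) (f B) (h B))
  where
  +-interchange : ∀ a b c d → a + b + (c + d) ≡ a + c + (b + d)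
  +-interchange = solve-∀

*-distribˡ-Σ< : (B x : ℕ) (f : ℕ → ℕ) → x * Σ< B f ≡ Σ< B (λ i → x * f i)
*-distribˡ-Σ< zero x f = *-zeroʳ x
*-distribˡ-Σ< (suc B) x f = trans (*-distribˡ-+ x (Σ< B f) (f B)) (cong (_+ x * f B) (*-distribˡ-Σ< B x f))

Σ<-suc : (B : ℕ) (f : ℕ → ℕ) → Σ< (suc B) f ≡ f 0 + Σ< B (λ i → f (suc i))
Σ<-suc zero f = +-comm 0 (f 0)
Σ<-suc (suc B) f = trans (cong (_+ f (suc B)) (Σ<-suc B f)) (+-assoc (f 0) _ _)

Σ<-+-range : (a b : ℕ) (f : ℕ → ℕ) → Σ< (a + b) f ≡ Σ< a f + Σ< b (λ i → f (a + i))
Σ<-+-range a zero f = trans (cong (λ B → Σ< B f) (+-identityʳ a)) (sym (+-identityʳ _))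
Σ<-+-range a (suc b) f = begin
  Σ< (a + suc b) f                              ≡⟨ cong (λ B → Σ< B f) (+-suc a b) ⟩
  Σ< (a + b) f + f (a + b)                      ≡⟨ cong (_+ f (a + b)) (Σ<-+-range a b f) ⟩
  Σ< a f + Σ< b (λ i → f (a + i)) + f (a + b)   ≡⟨ +-assoc (Σ< a f) _ _ ⟩
  Σ< a f + (Σ< b (λ i → f (a + i)) + f (a + b)) ∎

Σ<-reverse : (B : ℕ) (f : ℕ → ℕ) → Σ< B f ≡ Σ< B (λ i → f (B ∸ suc i))
Σ<-reverse zero f = refl
Σ<-reverse (suc B) f = begin
  Σ< B f + f B                            ≡⟨ +-comm (Σ< B f) (f B) ⟩
  f B + Σ< B f                            ≡⟨ cong (f B +_) (Σ<-reverse B f) ⟩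
  f B + Σ< B (λ i → f (B ∸ suc i))        ≡⟨ sym (Σ<-suc B (λ i → f (suc B ∸ suc i))) ⟩
  Σ< (suc B) (λ i → f (suc B ∸ suc i))    ∎

Σ<-triangle : (k : ℕ) (F : ℕ → ℕ → ℕ) → Σ< k (λ i → Σ< (k ∸ i) (F i)) ≡ Σ< k (λ b → Σ< (k ∸ b) (λ i → F i b))
Σ<-triangle zero F = refl
Σ<-triangle (suc k) F = begin
  Σ< (suc k) (λ i → Σ< (suc k ∸ i) (F i))
    ≡⟨ Σ<-suc k _ ⟩
  Σ< (suc k) (F 0) + Σ< k (λ i → Σ< (k ∸ i) (F (suc i)))
    ≡⟨ cong (Σ< (suc k) (F 0) +_) (Σ<-triangle k (λ i → F (suc i))) ⟩
  Σ< (suc k) (F 0) + Σ< k G                               ≡⟨ cong (Σ< (suc k) (F 0) +_) (sym last-term-empty) ⟩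
  Σ< (suc k) (F 0) + Σ< (suc k) G                         ≡⟨ sym (Σ<-+ (suc k) (F 0) G) ⟩
  Σ< (suc k) (λ b → F 0 b + Σ< (k ∸ b) (λ i → F (suc i) b))
    ≡⟨ Σ<-cong (suc k) peel ⟩
  Σ< (suc k) (λ b → Σ< (suc k ∸ b) (λ i → F i b)) ∎
  where
  G : ℕ → ℕ
  G b = Σ< (k ∸ b) (λ i → F (suc i) b)
  last-term-empty : Σ< (suc k) G ≡ Σ< k G
  last-term-empty = trans (cong (λ B → Σ< k G + Σ< B (λ i → F (suc i) k)) (n∸n≡0 k)) (+-identityʳ (Σ< k G))
  peel : ∀ b → b < suc k → F 0 b + Σ< (k ∸ b) (λ i → F (suc i) b) ≡ Σ< (suc k ∸ b) (λ i → F i b)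
  peel b (s≤s b≤k) = trans (sym (Σ<-suc (k ∸ b) (λ i → F i b))) (cong (λ B → Σ< B (λ i → F i b)) (sym (+-∸-assoc 1 b≤k)))

Σ<-mirror : (k : ℕ) (h : ℕ → ℕ) → Σ< k h + h k ≡ h 0 + Σ< k (λ b → h (k ∸ b))
Σ<-mirror k h = begin
  Σ< k h + h k                              ≡⟨ Σ<-suc k h ⟩
  h 0 + Σ< k (λ i → h (suc i))              ≡⟨ cong (h 0 +_) (Σ<-reverse k _) ⟩
  h 0 + Σ< k (λ i → h (suc (k ∸ suc i)))    ≡⟨ cong (h 0 +_) (Σ<-cong k λ i i<k → cong h (sym (+-∸-assoc 1 i<k))) ⟩
  h 0 + Σ< k (λ b → h (k ∸ b))              ∎

module SquareIdentity (γ : ℕ → ℕ) (recurrence : ∀ M → 1 ≤ M → Σ< M (λ j → j ! * γ (M ∸ j)) ≡ M !) (k : ℕ) where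

  T W P : ℕ
  T = Σ< k λ i → Σ< k λ j → i ! * j ! * γ (k + k ∸ i ∸ j)
  W = Σ< k λ b → (k + b) ! * (k ∸ b) !
  P = Σ< k λ i → i ! * (k + k ∸ i) !

  -- Split the recurrence for (2k - i)! at j = k; the upper part sums to W after swapping the order of summation.
  P≡T+W : P ≡ T + W
  P≡T+W = begin
    P                                                       ≡⟨ Σ<-cong k (λ i i<k → cong (i ! *_) (expand i i<k)) ⟩
    Σ< k (λ i → i ! * (Σ< k (lower i) + Σ< (k ∸ i) (upper i)))   ≡⟨ Σ<-cong k (λ i _ → *-distribˡ-+ (i !) _ _) ⟩
    Σ< k (λ i → i ! * Σ< k (lower i) + i ! * Σ< (k ∸ i) (upper i)) ≡⟨ Σ<-+ k _ _ ⟩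
    Σ< k (λ i → i ! * Σ< k (lower i)) + Σ< k (λ i → i ! * Σ< (k ∸ i) (upper i))
      ≡⟨ cong₂ _+_ (Σ<-cong k λ i _ → trans (*-distribˡ-Σ< k (i !) _) (Σ<-cong k λ j _ → sym (*-assoc (i !) (j !) _)))
                   (Σ<-cong k λ i _ → *-distribˡ-Σ< (k ∸ i) (i !) _) ⟩
    T + Σ< k (λ i → Σ< (k ∸ i) (λ b → i ! * upper i b))     ≡⟨ cong (T +_) (Σ<-triangle k _) ⟩
    T + Σ< k (λ b → Σ< (k ∸ b) (λ i → i ! * upper i b))     ≡⟨ cong (T +_) (Σ<-cong k inner) ⟩
    T + W ∎
    where
    lower upper : ℕ → ℕ → ℕ
    lower i j = j ! * γ (k + k ∸ i ∸ j)
    upper i b = (k + b) ! * γ (k + k ∸ i ∸ (k + b))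
    expand : ∀ i → i < k → (k + k ∸ i) ! ≡ Σ< k (lower i) + Σ< (k ∸ i) (upper i)
    expand i i<k = begin
      (k + k ∸ i) !                                   ≡⟨ sym (recurrence (k + k ∸ i) 1≤) ⟩
      Σ< (k + k ∸ i) (lower i)                        ≡⟨ cong (λ B → Σ< B (lower i)) (+-∸-assoc k (<⇒≤ i<k)) ⟩
      Σ< (k + (k ∸ i)) (lower i)                      ≡⟨ Σ<-+-range k (k ∸ i) (lower i) ⟩
      Σ< k (lower i) + Σ< (k ∸ i) (upper i)           ∎
      where
      1≤ : 1 ≤ k + k ∸ i
      1≤ = subst (1 ≤_) (sym (+-∸-assoc k (<⇒≤ i<k))) (≤-trans (≤-trans (s≤s z≤n) i<k) (m≤m+n k (k ∸ i)))
    shift : ∀ i b → k + k ∸ i ∸ (k + b) ≡ k ∸ b ∸ i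
    shift i b = begin
      k + k ∸ i ∸ (k + b)   ≡⟨ ∸-+-assoc (k + k) i (k + b) ⟩
      k + k ∸ (i + (k + b)) ≡⟨ cong (k + k ∸_) (rearrange i k b) ⟩
      k + k ∸ (k + (b + i)) ≡⟨ [m+n]∸[m+o]≡n∸o k k (b + i) ⟩
      k ∸ (b + i)           ≡⟨ sym (∸-+-assoc k b i) ⟩
      k ∸ b ∸ i             ∎
      where
      rearrange : ∀ i k b → i + (k + b) ≡ k + (b + i)
      rearrange = solve-∀
    inner : ∀ b → b < k → Σ< (k ∸ b) (λ i → i ! * upper i b) ≡ (k + b) ! * (k ∸ b) !
    inner b b<k = begin
      Σ< (k ∸ b) (λ i → i ! * upper i b)                 ≡⟨ Σ<-cong (k ∸ b) (λ i _ → trans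
                                                              (cong (λ z → i ! * ((k + b) ! * γ z)) (shift i b))
                                                              (*-left-comm (i !) ((k + b) !) _)) ⟩
      Σ< (k ∸ b) (λ i → (k + b) ! * (i ! * γ (k ∸ b ∸ i))) ≡⟨ sym (*-distribˡ-Σ< (k ∸ b) ((k + b) !) _) ⟩
      (k + b) ! * Σ< (k ∸ b) (λ i → i ! * γ (k ∸ b ∸ i))   ≡⟨ cong ((k + b) ! *_) (recurrence (k ∸ b) (m<n⇒0<n∸m b<k)) ⟩
      (k + b) ! * (k ∸ b) !                                ∎
      where
      *-left-comm : ∀ x y z → x * (y * z) ≡ y * (x * z)
      *-left-comm = solve-∀

  -- With h i = i! (2k - i)!, both sides are Σ_{i ≤ k} h i.
  P+k!k!≡[k+k]!+W : P + k ! * k ! ≡ (k + k) ! + W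
  P+k!k!≡[k+k]!+W = begin
    P + k ! * k !                    ≡⟨ cong (λ x → P + k ! * x !) (sym (m+n∸m≡n k k)) ⟩
    P + h k                          ≡⟨ Σ<-mirror k h ⟩
    h 0 + Σ< k (λ b → h (k ∸ b))     ≡⟨ cong₂ _+_ (*-identityˡ ((k + k) !)) (Σ<-cong k mirror) ⟩
    (k + k) ! + W                    ∎
    where
    h : ℕ → ℕ
    h i = i ! * (k + k ∸ i) !
    mirror : ∀ b → b < k → h (k ∸ b) ≡ (k + b) ! * (k ∸ b) !
    mirror b b<k = begin
      (k ∸ b) ! * (k + k ∸ (k ∸ b)) !    ≡⟨ cong (λ x → (k ∸ b) ! * x !) (trans (+-∸-assoc k (m∸n≤m k b)) (cong (k +_) (m∸[m∸n]≡n (<⇒≤ b<k)))) ⟩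
      (k ∸ b) ! * (k + b) !              ≡⟨ *-comm ((k ∸ b) !) _ ⟩
      (k + b) ! * (k ∸ b) !              ∎

  T+k!k!≡[k+k]! : T + k ! * k ! ≡ (k + k) !
  T+k!k!≡[k+k]! = +-cancelʳ-≡ W _ _ (begin
    T + k ! * k ! + W   ≡⟨ +-right-comm T _ _ ⟩
    T + W + k ! * k !   ≡⟨ cong (_+ k ! * k !) (sym P≡T+W) ⟩
    P + k ! * k !       ≡⟨ P+k!k!≡[k+k]!+W ⟩
    (k + k) ! + W       ∎)
    where
    +-right-comm : ∀ a b c → a + b + c ≡ a + c + b
    +-right-comm = solve-∀

sum1to-Σ< : (n : ℕ) (f : ℕ → ℕ) → sum1to n f ≡ Σ< n (λ i → f (suc i))
sum1to-Σ< n f = go n (λ i → i)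
  where
  go : (n : ℕ) (h : ℕ → ℕ) → sum (map f (map suc (applyUpTo h n))) ≡ Σ< n (λ i → f (suc (h i)))
  go zero h = refl
  go (suc n) h = trans (cong (f (suc (h 0)) +_) (go n (λ i → h (suc i)))) (sym (Σ<-suc n (λ i → f (suc (h i)))))

module _ (γ : ℕ → ℕ) (recurrence : ∀ M → 1 ≤ M → Σ< M (λ j → j ! * γ (M ∸ j)) ≡ M !) (n : ℕ) where
  open SquareIdentity γ recurrence (suc n)

  private
    k : ℕ
    k = suc n

  -- The terms of T with i = 0 or j = 0 contribute γ(2k) and twice the single sum.
  square-identity-sum1to : k ! * k ! + sum1to n (λ i → sum1to n (λ j → i ! * j ! * γ (k + k ∸ i ∸ j)))
                        + 2 * sum1to n (λ i → i ! * γ (k + k ∸ i)) + γ (k + k) ≡ (k + k) !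
  square-identity-sum1to = begin
    k ! * k ! + sum1to n (λ i → sum1to n (λ j → i ! * j ! * γ (k + k ∸ i ∸ j))) + 2 * sum1to n (λ i → i ! * γ (k + k ∸ i)) + γ (k + k)
      ≡⟨ cong₂ (λ x y → k ! * k ! + x + 2 * y + γ (k + k)) (trans (sum1to-Σ< n _) (Σ<-cong n λ i _ → sum1to-Σ< n _)) (sum1to-Σ< n _) ⟩
    k ! * k ! + S₂ + 2 * S₁ + γ (k + k)          ≡⟨ rearrange (k ! * k !) S₂ S₁ (γ (k + k)) ⟩
    (γ (k + k) + S₁) + (S₁ + S₂) + k ! * k !     ≡⟨ cong (_+ k ! * k !) (sym T≡) ⟩
    T + k ! * k !                                 ≡⟨ T+k!k!≡[k+k]! ⟩
    (k + k) !                                     ∎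
    where
    S₁ S₂ : ℕ
    S₁ = Σ< n λ j → suc j ! * γ (k + k ∸ suc j)
    S₂ = Σ< n λ i → Σ< n λ j → suc i ! * suc j ! * γ (k + k ∸ suc i ∸ suc j)
    rearrange : ∀ a b s x → a + b + 2 * s + x ≡ (x + s) + (s + b) + a
    rearrange = solve-∀
    T≡ : T ≡ (γ (k + k) + S₁) + (S₁ + S₂)
    T≡ = begin
      T ≡⟨ Σ<-suc n _ ⟩
      Σ< k (λ j → 1 * j ! * γ (k + k ∸ j)) + Σ< n (λ i → Σ< k (λ j → suc i ! * j ! * γ (k + k ∸ suc i ∸ j)))
        ≡⟨ cong₂ _+_ (Σ<-suc n _) (Σ<-cong n λ i _ → Σ<-suc n _) ⟩
      (1 * γ (k + k) + Σ< n (λ j → 1 * suc j ! * γ (k + k ∸ suc j)))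
        + Σ< n (λ i → suc i ! * 1 * γ (k + k ∸ suc i) + Σ< n (λ j → suc i ! * suc j ! * γ (k + k ∸ suc i ∸ suc j)))
        ≡⟨ cong₂ _+_ (cong₂ _+_ (*-identityˡ _) (Σ<-cong n λ j _ → cong (_* γ (k + k ∸ suc j)) (*-identityˡ (suc j !))))
                     (trans (Σ<-+ n _ _) (cong (_+ S₂) (Σ<-cong n λ i _ → cong (_* γ (k + k ∸ suc i)) (*-identityʳ (suc i !))))) ⟩
      (γ (k + k) + S₁) + (S₁ + S₂) ∎

-- NoSubdivCount t₁ t₂ N is Card applied to the gluings without subdivergence.
Card : {A : Set} → Pred A 0ℓ → ℕ → Set
Card {A} P N = Σ (List A) λ L → Unique L × (∀ a → (a ∈ L → P a) × (P a → a ∈ L)) × length L ≡ N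

record InjectionOn {A B : Set} (P : Pred A 0ℓ) (Q : Pred B 0ℓ) : Set where
  field
    to        : A → B
    to-∈      : ∀ {a} → P a → Q (to a)
    injective : ∀ {a b} → P a → P b → to a ≡ to b → a ≡ b

involution-injectionOn : {A : Set} {P Q : Pred A 0ℓ} (f : A → A) → (∀ a → f (f a) ≡ a) →
  (∀ {a} → P a → Q (f a)) → InjectionOn P Q
involution-injectionOn f involutive f-∈ = record
  { to = f ; to-∈ = f-∈ ; injective = λ {a} {b} _ _ eq → trans (sym (involutive a)) (trans (cong f eq) (involutive b)) }

Unique⇒lookup-injective : {A : Set} {L : List A} → Unique L →
  ∀ i j → List.lookup L i ≡ List.lookup L j → i ≡ j
Unique⇒lookup-injective (_ ∷ _) zero zero _ = refl
Unique⇒lookup-injective (x∉ ∷ _) zero (suc j) eq = ⊥-elim (All.lookup x∉ (∈-lookup j) eq)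
Unique⇒lookup-injective (x∉ ∷ _) (suc i) zero eq = ⊥-elim (All.lookup x∉ (∈-lookup i) (sym eq))
Unique⇒lookup-injective (_ ∷ u) (suc i) (suc j) eq = cong suc (Unique⇒lookup-injective u i j eq)

card-≤ : {A B : Set} {P : Pred A 0ℓ} {Q : Pred B 0ℓ} {n m : ℕ} →
  Card P n → Card Q m → InjectionOn P Q → n ≤ m
card-≤ {P = P} (L , L! , L-spec , refl) (M , _ , M-spec , refl) ι = injective⇒≤ {f = position} position-injective
  where
  open InjectionOn ι
  P-lookup : ∀ i → P (List.lookup L i)
  P-lookup i = proj₁ (L-spec _) (∈-lookup i)
  to-lookup∈M : ∀ i → to (List.lookup L i) ∈ M
  to-lookup∈M i = proj₂ (M-spec _) (to-∈ (P-lookup i))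
  position : Fin (length L) → Fin (length M)
  position i = index (to-lookup∈M i)
  position-injective : ∀ {i j} → position i ≡ position j → i ≡ j
  position-injective {i} {j} eq = Unique⇒lookup-injective L! i j
    (injective (P-lookup i) (P-lookup j) (index-injective (setoid _) (to-lookup∈M i) (to-lookup∈M j) eq))

card-≡ : {A B : Set} {P : Pred A 0ℓ} {Q : Pred B 0ℓ} {n m : ℕ} →
  Card P n → Card Q m → InjectionOn P Q → InjectionOn Q P → n ≡ m
card-≡ cP cQ ι κ = ≤-antisym (card-≤ cP cQ ι) (card-≤ cQ cP κ)

card-cong : {A : Set} {P Q : Pred A 0ℓ} {n : ℕ} → Card P n → P ≐ Q → Card Q n
card-cong (L , L! , L-spec , len) (P⊆Q , Q⊆P) =
  L , L! , (λ a → (λ a∈L → P⊆Q (proj₁ (L-spec a) a∈L)) , (λ q → proj₂ (L-spec a) (Q⊆P q))) , len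

card-unique : {A : Set} {P Q : Pred A 0ℓ} {n m : ℕ} → Card P n → Card Q m → P ≐ Q → n ≡ m
card-unique cP cQ (P⊆Q , Q⊆P) = card-≡ cP cQ
  (record { to = λ a → a ; to-∈ = P⊆Q ; injective = λ _ _ eq → eq })
  (record { to = λ a → a ; to-∈ = Q⊆P ; injective = λ _ _ eq → eq })

card-∪ : {A : Set} {P Q : Pred A 0ℓ} {n m : ℕ} → Card P n → Card Q m →
  (∀ {a} → P a → Q a → ⊥) → Card (P ∪ Q) (n + m)
card-∪ {P = P} {Q} (L , L! , L-spec , refl) (M , M! , M-spec , refl) disjoint =
  L ++ M , Unique.++⁺ L! M! (λ (a∈L , a∈M) → disjoint (proj₁ (L-spec _) a∈L) (proj₁ (M-spec _) a∈M)) ,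
  (λ a → from-++ a , to-++ a) , length-++ L
  where
  from-++ : ∀ a → a ∈ L ++ M → (P ∪ Q) a
  from-++ a a∈ with ∈-++⁻ L a∈
  ... | inj₁ a∈L = inj₁ (proj₁ (L-spec a) a∈L)
  ... | inj₂ a∈M = inj₂ (proj₁ (M-spec a) a∈M)
  to-++ : ∀ a → (P ∪ Q) a → a ∈ L ++ M
  to-++ a (inj₁ p) = ∈-++⁺ˡ (proj₂ (L-spec a) p)
  to-++ a (inj₂ q) = ∈-++⁺ʳ L (proj₂ (M-spec a) q)

length-cartesianProductWith : {A B C : Set} (f : A → B → C) (xs : List A) (ys : List B) →
  length (cartesianProductWith f xs ys) ≡ length xs * length ys
length-cartesianProductWith f [] ys = refl
length-cartesianProductWith f (x ∷ xs) ys = trans (length-++ (map (f x) ys))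
  (cong₂ _+_ (length-map (f x) ys) (length-cartesianProductWith f xs ys))

card-⟨×⟩ : {A B : Set} {P : Pred A 0ℓ} {Q : Pred B 0ℓ} {n m : ℕ} →
  Card P n → Card Q m → Card (P ⟨×⟩ Q) (n * m)
card-⟨×⟩ {P = P} {Q} (L , L! , L-spec , refl) (M , M! , M-spec , refl) =
  cartesianProductWith _,_ L M ,
  Unique.cartesianProductWith⁺ _,_ (λ { refl → refl , refl }) L! M! ,
  (λ (a , b) → from-product , λ (p , q) → ∈-cartesianProductWith⁺ _,_ (proj₂ (L-spec a) p) (proj₂ (M-spec b) q)) ,
  length-cartesianProductWith _,_ L M
  where
  from-product : ∀ {a b} → (a , b) ∈ cartesianProductWith _,_ L M → (P ⟨×⟩ Q) (a , b)
  from-product ab∈ with ∈-cartesianProductWith⁻ _,_ L M ab∈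
  ... | a , b , a∈L , b∈M , refl = proj₁ (L-spec a) a∈L , proj₁ (M-spec b) b∈M

card-Fin : (m : ℕ) → Card {Fin m} U m
card-Fin m = allFin m , Unique.allFin⁺ m , (λ a → (λ _ → tt) , (λ _ → ∈-allFin a)) , length-tabulate (λ i → i)

allVecs-suc : (m n : ℕ) → allVecs m (suc n) ≡ cartesianProductWith _∷_ (allFin m) (allVecs m n)
allVecs-suc m n = concatMap-cartesian (allFin m)
  where
  concatMap-cartesian : (xs : List (Fin m)) →
    concatMap (λ x → map (x ∷_) (allVecs m n)) xs ≡ cartesianProductWith _∷_ xs (allVecs m n)
  concatMap-cartesian [] = refl
  concatMap-cartesian (x ∷ xs) = cong (map (x ∷_) (allVecs m n) ++_) (concatMap-cartesian xs)

allVecs-unique : (m n : ℕ) → Unique (allVecs m n)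
allVecs-unique m zero = All.[] ∷ []
allVecs-unique m (suc n) = subst Unique (sym (allVecs-suc m n))
  (Unique.cartesianProductWith⁺ _∷_ ∷-injective (Unique.allFin⁺ m) (allVecs-unique m n))

∈-allVecs : (m n : ℕ) (v : Vec (Fin m) n) → v ∈ allVecs m n
∈-allVecs m zero [] = here refl
∈-allVecs m (suc n) (x ∷ v) = subst ((x ∷ v) ∈_) (sym (allVecs-suc m n))
  (∈-cartesianProductWith⁺ _∷_ (∈-allFin x) (∈-allVecs m n v))

card-filter : {m n : ℕ} {P : Pred (Vec (Fin m) n) 0ℓ} (P? : Decidable P) →
  Card P (length (filter P? (allVecs m n)))
card-filter {m} {n} P? =
  filter P? (allVecs m n) , Unique.filter⁺ P? {allVecs m n} (allVecs-unique m n) ,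
  (λ v → (λ v∈ → proj₂ (∈-filter⁻ P? {xs = allVecs m n} v∈)) , (λ p → ∈-filter⁺ P? (∈-allVecs m n v) p)) , refl

lookup-extensionality : {A : Set} {n : ℕ} (u v : Vec A n) → (∀ i → lookup u i ≡ lookup v i) → u ≡ v
lookup-extensionality u v eq = trans (sym (tabulate∘lookup u)) (trans (tabulate-cong eq) (tabulate∘lookup v))

IsPerm : (m : ℕ) → Pred (Vec (Fin m) m) 0ℓ
IsPerm m v = IsBij (lookup v)

punchOutOr : {m : ℕ} → Fin (suc m) → Fin (suc m) → Fin m → Fin m
punchOutOr x y d with x ≟ꟳ y
... | yes _ = d
... | no x≢y = punchOut x≢y

punchOutOr-≢ : {m : ℕ} {x y : Fin (suc m)} (d : Fin m) (x≢y : x ≢ y) → punchOutOr x y d ≡ punchOut x≢y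
punchOutOr-≢ {x = x} {y} d x≢y with x ≟ꟳ y
... | yes x≡y = ⊥-elim (x≢y x≡y)
... | no _ = punchOut-cong x refl

-- On a permutation the head never recurs in the tail, so the default argument of punchOutOr is never used.
detachHead : {m : ℕ} → Vec (Fin (suc m)) (suc m) → Fin (suc m) × Vec (Fin m) m
detachHead (x ∷ w) = x , tabulate (λ i → punchOutOr x (lookup w i) i)

attachHead : {m : ℕ} → Fin (suc m) × Vec (Fin m) m → Vec (Fin (suc m)) (suc m)
attachHead (x , u) = x ∷ mapᵥ (punchIn x) u

module _ {m : ℕ} {x : Fin (suc m)} {w : Vec (Fin (suc m)) m} (perm : IsPerm (suc m) (x ∷ w)) where

  head∉tail : ∀ i → x ≢ lookup w i
  head∉tail i eq with proj₁ perm zero (suc i) eq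
  ... | ()

  lookup-detachHead : ∀ i → lookup (proj₂ (detachHead (x ∷ w))) i ≡ punchOut (head∉tail i)
  lookup-detachHead i = trans (lookup∘tabulate _ i) (punchOutOr-≢ i (head∉tail i))

detachHead-perm : {m : ℕ} {v : Vec (Fin (suc m)) (suc m)} → IsPerm (suc m) v → IsPerm m (proj₂ (detachHead v))
detachHead-perm {m} {x ∷ w} perm = injective , surjective
  where
  tail′ : Vec (Fin m) m
  tail′ = proj₂ (detachHead (x ∷ w))
  injective : ∀ i j → lookup tail′ i ≡ lookup tail′ j → i ≡ j
  injective i j eq with proj₁ perm (suc i) (suc j)
    (punchOut-injective (head∉tail perm i) (head∉tail perm j)
      (trans (sym (lookup-detachHead perm i)) (trans eq (lookup-detachHead perm j))))
  ... | refl = refl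
  surjective : ∀ y → ∃ λ i → lookup tail′ i ≡ y
  surjective y with proj₂ perm (punchIn x y)
  ... | zero , eq = ⊥-elim (punchInᵢ≢i x y (sym eq))
  ... | suc i , eq = i , trans (lookup-detachHead perm i) (trans (punchOut-cong x eq) (punchOut-punchIn x))

attachHead-perm : {m : ℕ} (p : Fin (suc m) × Vec (Fin m) m) → IsPerm m (proj₂ p) → IsPerm (suc m) (attachHead p)
attachHead-perm {m} (x , u) (u-injective , u-surjective) = injective , surjective
  where
  lookup-tail : ∀ i → lookup (mapᵥ (punchIn x) u) i ≡ punchIn x (lookup u i)
  lookup-tail i = lookup-map i (punchIn x) u
  injective : ∀ i j → lookup (attachHead (x , u)) i ≡ lookup (attachHead (x , u)) j → i ≡ j
  injective zero zero _ = refl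
  injective zero (suc j) eq = ⊥-elim (punchInᵢ≢i x _ (sym (trans eq (lookup-tail j))))
  injective (suc i) zero eq = ⊥-elim (punchInᵢ≢i x _ (trans (sym (lookup-tail i)) eq))
  injective (suc i) (suc j) eq =
    cong suc (u-injective i j (punchIn-injective x _ _ (trans (sym (lookup-tail i)) (trans eq (lookup-tail j)))))
  surjective : ∀ y → ∃ λ i → lookup (attachHead (x , u)) i ≡ y
  surjective y with x ≟ꟳ y
  ... | yes x≡y = zero , x≡y
  ... | no x≢y with u-surjective (punchOut x≢y)
  ...   | i , eq = suc i , trans (lookup-tail i) (trans (cong (punchIn x) eq) (punchIn-punchOut x≢y))

detachHead-injective : {m : ℕ} {v v′ : Vec (Fin (suc m)) (suc m)} → IsPerm (suc m) v → IsPerm (suc m) v′ →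
  detachHead v ≡ detachHead v′ → v ≡ v′
detachHead-injective {v = x ∷ w} {x′ ∷ w′} perm perm′ eq with cong proj₁ eq
... | refl = cong (x ∷_) (lookup-extensionality w w′ λ i → punchOut-injective (head∉tail perm i) (head∉tail perm′ i)
  (trans (sym (lookup-detachHead perm i)) (trans (cong (λ p → lookup (proj₂ p) i) eq) (lookup-detachHead perm′ i))))

attachHead-injective : {m : ℕ} {p q : Fin (suc m) × Vec (Fin m) m} → attachHead p ≡ attachHead q → p ≡ q
attachHead-injective {p = x , u} {_ , u′} eq with ∷-injective eq
... | refl , tails = cong (x ,_) (lookup-extensionality u u′ λ i → punchIn-injective x _ _
  (trans (sym (lookup-map i (punchIn x) u)) (trans (cong (λ t → lookup t i) tails) (lookup-map i (punchIn x) u′))))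

IsPerm? : (m : ℕ) → Decidable (IsPerm m)
IsPerm? m v = IsBij? (lookup v)

card-IsPerm : (m : ℕ) → Card (IsPerm m) (m !)
card-IsPerm zero = [] ∷ [] , All.[] ∷ [] , (λ { [] → (λ _ → (λ ()) , (λ ())) , (λ _ → here refl) }) , refl
card-IsPerm (suc m) = subst (Card (IsPerm (suc m))) count (card-filter (IsPerm? (suc m)))
  where
  count : length (filter (IsPerm? (suc m)) (allVecs (suc m) (suc m))) ≡ suc m * m !
  count = card-≡ (card-filter (IsPerm? (suc m))) (card-⟨×⟩ (card-Fin (suc m)) (card-IsPerm m))
    (record { to = detachHead ; to-∈ = λ {v} perm → tt , detachHead-perm {v = v} perm ; injective = detachHead-injective })
    (record { to = attachHead ; to-∈ = λ {p} (_ , perm) → attachHead-perm p perm ; injective = λ _ _ → attachHead-injective })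

-- Cutting a permutation into a direct sum

PrefixStable : {M : ℕ} → (Fin M → Fin M) → ℕ → Set
PrefixStable {M} f r = (i : Fin M) → (toℕ i < r → toℕ (f i) < r) × (toℕ (f i) < r → toℕ i < r)

PrefixStable? : {M : ℕ} (f : Fin M → Fin M) (r : ℕ) → Dec (PrefixStable f r)
PrefixStable? f r = all? λ i → ((toℕ i <? r) →-dec (toℕ (f i) <? r)) ×-dec ((toℕ (f i) <? r) →-dec (toℕ i <? r))

module _ {M : ℕ} {f : Fin M → Fin M} (bij : IsBij f) {r : ℕ} where

  ImageIs⇒PrefixStable : ImageIs f r → PrefixStable f r
  ImageIs⇒PrefixStable image i = (λ i<r → proj₂ (image (f i)) (i , i<r , refl)) , preimage-< ∘ proj₁ (image (f i))
    where
    preimage-< : (∃ λ i′ → toℕ i′ < r × f i′ ≡ f i) → toℕ i < r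
    preimage-< (i′ , i′<r , eq) = subst (λ z → toℕ z < r) (proj₁ bij i′ i eq) i′<r

  PrefixStable⇒ImageIs : PrefixStable f r → ImageIs f r
  PrefixStable⇒ImageIs stable y = (λ y<r → preimage y<r (proj₂ bij y)) , λ { (i , i<r , refl) → proj₁ (stable i) i<r }
    where
    preimage : toℕ y < r → (∃ λ x → f x ≡ y) → ∃ λ i → toℕ i < r × f i ≡ y
    preimage y<r (x , refl) = x , proj₂ (stable x) y<r , refl

data Split (j s : ℕ) : Fin (j + s) → Set where
  left  : (i : Fin j) → Split j s (i ↑ˡ s)
  right : (i : Fin s) → Split j s (j ↑ʳ i)

split : (j s : ℕ) (k : Fin (j + s)) → Split j s k
split j s k with splitAt j k in eq
... | inj₁ i with k | splitAt⁻¹-↑ˡ eq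
...   | _ | refl = left i
split j s k | inj₂ i with k | splitAt⁻¹-↑ʳ eq
...   | _ | refl = right i

module _ {j s : ℕ} where

  toℕ-↑ˡ< : (i : Fin j) → toℕ (i ↑ˡ s) < j
  toℕ-↑ˡ< i = subst (_< j) (sym (toℕ-↑ˡ i s)) (toℕ<n i)

  ≤toℕ-↑ʳ : (i : Fin s) → j ≤ toℕ (j ↑ʳ i)
  ≤toℕ-↑ʳ i = subst (j ≤_) (sym (toℕ-↑ʳ j i)) (m≤m+n j (toℕ i))

  ↑ˡ≢↑ʳ : (i : Fin j) (i′ : Fin s) → i ↑ˡ s ≢ j ↑ʳ i′
  ↑ˡ≢↑ʳ i i′ eq = <⇒≱ (toℕ-↑ˡ< i) (subst (λ z → j ≤ toℕ z) (sym eq) (≤toℕ-↑ʳ i′))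

  _⊕_ : Vec (Fin j) j → Vec (Fin s) s → Vec (Fin (j + s)) (j + s)
  a ⊕ b = mapᵥ (_↑ˡ s) a ++ᵥ mapᵥ (j ↑ʳ_) b

  lookup-⊕-↑ˡ : (a : Vec (Fin j) j) (b : Vec (Fin s) s) (i : Fin j) → lookup (a ⊕ b) (i ↑ˡ s) ≡ lookup a i ↑ˡ s
  lookup-⊕-↑ˡ a b i = trans (lookup-++ˡ (mapᵥ (_↑ˡ s) a) (mapᵥ (j ↑ʳ_) b) i) (lookup-map i (_↑ˡ s) a)

  lookup-⊕-↑ʳ : (a : Vec (Fin j) j) (b : Vec (Fin s) s) (i : Fin s) → lookup (a ⊕ b) (j ↑ʳ i) ≡ j ↑ʳ lookup b i
  lookup-⊕-↑ʳ a b i = trans (lookup-++ʳ (mapᵥ (_↑ˡ s) a) (mapᵥ (j ↑ʳ_) b) i) (lookup-map i (j ↑ʳ_) b)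

  ⊕-injective : {a a′ : Vec (Fin j) j} {b b′ : Vec (Fin s) s} → a ⊕ b ≡ a′ ⊕ b′ → (a , b) ≡ (a′ , b′)
  ⊕-injective {a} {a′} {b} {b′} eq = cong₂ _,_
    (lookup-extensionality a a′ λ i → ↑ˡ-injective s _ _
      (trans (sym (lookup-⊕-↑ˡ a b i)) (trans (cong (λ v → lookup v (i ↑ˡ s)) eq) (lookup-⊕-↑ˡ a′ b′ i))))
    (lookup-extensionality b b′ λ i → ↑ʳ-injective j _ _
      (trans (sym (lookup-⊕-↑ʳ a b i)) (trans (cong (λ v → lookup v (j ↑ʳ i)) eq) (lookup-⊕-↑ʳ a′ b′ i))))

  leftPartOr : Fin (j + s) → Fin j → Fin j
  leftPartOr k d with split j s k
  ... | left x = x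
  ... | right _ = d

  rightPartOr : Fin (j + s) → Fin s → Fin s
  rightPartOr k d with split j s k
  ... | left _ = d
  ... | right x = x

  leftPartOr-↑ˡ : (k : Fin (j + s)) (d : Fin j) → toℕ k < j → leftPartOr k d ↑ˡ s ≡ k
  leftPartOr-↑ˡ k d k<j with split j s k
  ... | left x = refl
  ... | right x = ⊥-elim (<⇒≱ k<j (≤toℕ-↑ʳ x))

  rightPartOr-↑ʳ : (k : Fin (j + s)) (d : Fin s) → j ≤ toℕ k → j ↑ʳ rightPartOr k d ≡ k
  rightPartOr-↑ʳ k d j≤k with split j s k
  ... | left x = ⊥-elim (<⇒≱ (toℕ-↑ˡ< x) j≤k)
  ... | right x = refl

  restrictˡ : Vec (Fin (j + s)) (j + s) → Vec (Fin j) j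
  restrictˡ v = tabulate λ i → leftPartOr (lookup v (i ↑ˡ s)) i

  restrictʳ : Vec (Fin (j + s)) (j + s) → Vec (Fin s) s
  restrictʳ v = tabulate λ i → rightPartOr (lookup v (j ↑ʳ i)) i

  ⊕-restrict : (v : Vec (Fin (j + s)) (j + s)) → PrefixStable (lookup v) j → restrictˡ v ⊕ restrictʳ v ≡ v
  ⊕-restrict v stable = lookup-extensionality _ v pointwise
    where
    pointwise : ∀ k → lookup (restrictˡ v ⊕ restrictʳ v) k ≡ lookup v k
    pointwise k with split j s k
    ... | left i = begin
      lookup (restrictˡ v ⊕ restrictʳ v) (i ↑ˡ s)  ≡⟨ lookup-⊕-↑ˡ (restrictˡ v) (restrictʳ v) i ⟩
      lookup (restrictˡ v) i ↑ˡ s                  ≡⟨ cong (_↑ˡ s) (lookup∘tabulate _ i) ⟩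
      leftPartOr (lookup v (i ↑ˡ s)) i ↑ˡ s         ≡⟨ leftPartOr-↑ˡ _ i (proj₁ (stable (i ↑ˡ s)) (toℕ-↑ˡ< i)) ⟩
      lookup v (i ↑ˡ s)                            ∎
    ... | right i = begin
      lookup (restrictˡ v ⊕ restrictʳ v) (j ↑ʳ i)  ≡⟨ lookup-⊕-↑ʳ (restrictˡ v) (restrictʳ v) i ⟩
      j ↑ʳ lookup (restrictʳ v) i                  ≡⟨ cong (j ↑ʳ_) (lookup∘tabulate _ i) ⟩
      j ↑ʳ rightPartOr (lookup v (j ↑ʳ i)) i        ≡⟨ rightPartOr-↑ʳ _ i j≤ ⟩
      lookup v (j ↑ʳ i)                            ∎
      where
      j≤ : j ≤ toℕ (lookup v (j ↑ʳ i))
      j≤ with ≤-<-connex j (toℕ (lookup v (j ↑ʳ i)))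
      ... | inj₁ j≤v = j≤v
      ... | inj₂ v<j = ⊥-elim (<⇒≱ (proj₂ (stable (j ↑ʳ i)) v<j) (≤toℕ-↑ʳ i))

  module _ (a : Vec (Fin j) j) (b : Vec (Fin s) s) where

    ⊕-perm⁺ : IsPerm j a → IsPerm s b → IsPerm (j + s) (a ⊕ b)
    ⊕-perm⁺ (a-injective , a-surjective) (b-injective , b-surjective) = injective , surjective
      where
      injective : ∀ k k′ → lookup (a ⊕ b) k ≡ lookup (a ⊕ b) k′ → k ≡ k′
      injective k k′ eq with split j s k | split j s k′
      ... | left i | left i′ = cong (_↑ˡ s) (a-injective i i′ (↑ˡ-injective s _ _
            (trans (sym (lookup-⊕-↑ˡ a b i)) (trans eq (lookup-⊕-↑ˡ a b i′)))))
      ... | left i | right i′ = ⊥-elim (↑ˡ≢↑ʳ _ _ (trans (sym (lookup-⊕-↑ˡ a b i)) (trans eq (lookup-⊕-↑ʳ a b i′))))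
      ... | right i | left i′ = ⊥-elim (↑ˡ≢↑ʳ _ _ (trans (sym (lookup-⊕-↑ˡ a b i′)) (trans (sym eq) (lookup-⊕-↑ʳ a b i))))
      ... | right i | right i′ = cong (j ↑ʳ_) (b-injective i i′ (↑ʳ-injective j _ _
            (trans (sym (lookup-⊕-↑ʳ a b i)) (trans eq (lookup-⊕-↑ʳ a b i′)))))
      surjective : ∀ y → ∃ λ k → lookup (a ⊕ b) k ≡ y
      surjective y with split j s y
      ... | left x = let (i , eq) = a-surjective x in i ↑ˡ s , trans (lookup-⊕-↑ˡ a b i) (cong (_↑ˡ s) eq)
      ... | right x = let (i , eq) = b-surjective x in j ↑ʳ i , trans (lookup-⊕-↑ʳ a b i) (cong (j ↑ʳ_) eq)

    ⊕-perm⁻ : IsPerm (j + s) (a ⊕ b) → IsPerm j a × IsPerm s b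
    ⊕-perm⁻ (injective , surjective) = (a-injective , a-surjective) , (b-injective , b-surjective)
      where
      a-injective : ∀ i i′ → lookup a i ≡ lookup a i′ → i ≡ i′
      a-injective i i′ eq = ↑ˡ-injective s i i′ (injective _ _
        (trans (lookup-⊕-↑ˡ a b i) (trans (cong (_↑ˡ s) eq) (sym (lookup-⊕-↑ˡ a b i′)))))
      b-injective : ∀ i i′ → lookup b i ≡ lookup b i′ → i ≡ i′
      b-injective i i′ eq = ↑ʳ-injective j i i′ (injective _ _
        (trans (lookup-⊕-↑ʳ a b i) (trans (cong (j ↑ʳ_) eq) (sym (lookup-⊕-↑ʳ a b i′)))))
      a-surjective : ∀ x → ∃ λ i → lookup a i ≡ x
      a-surjective x with surjective (x ↑ˡ s)
      ... | k , eq with split j s k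
      ...   | left i = i , ↑ˡ-injective s _ _ (trans (sym (lookup-⊕-↑ˡ a b i)) eq)
      ...   | right i = ⊥-elim (↑ˡ≢↑ʳ _ _ (trans (sym eq) (lookup-⊕-↑ʳ a b i)))
      b-surjective : ∀ x → ∃ λ i → lookup b i ≡ x
      b-surjective x with surjective (j ↑ʳ x)
      ... | k , eq with split j s k
      ...   | left i = ⊥-elim (↑ˡ≢↑ʳ _ _ (trans (sym (lookup-⊕-↑ˡ a b i)) eq))
      ...   | right i = i , ↑ʳ-injective j _ _ (trans (sym (lookup-⊕-↑ʳ a b i)) eq)

    ⊕-prefixStable : PrefixStable (lookup (a ⊕ b)) j
    ⊕-prefixStable k with split j s k
    ... | left i = (λ _ → subst (λ z → toℕ z < j) (sym (lookup-⊕-↑ˡ a b i)) (toℕ-↑ˡ< _)) , (λ _ → toℕ-↑ˡ< i)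
    ... | right i = (λ i<j → ⊥-elim (<⇒≱ i<j (≤toℕ-↑ʳ i))) ,
                    (λ b<j → ⊥-elim (<⇒≱ b<j (subst (λ z → j ≤ toℕ z) (sym (lookup-⊕-↑ʳ a b i)) (≤toℕ-↑ʳ _))))

    toℕ-lookup-⊕-↑ʳ : ∀ i → toℕ (lookup (a ⊕ b) (j ↑ʳ i)) ≡ j + toℕ (lookup b i)
    toℕ-lookup-⊕-↑ʳ i = trans (cong toℕ (lookup-⊕-↑ʳ a b i)) (toℕ-↑ʳ j _)

    ⊕-prefixStable-shift⁻ : (r : ℕ) → PrefixStable (lookup (a ⊕ b)) (j + r) → PrefixStable (lookup b) r
    ⊕-prefixStable-shift⁻ r stable i =
      (λ i<r → +-cancelˡ-< j _ _ (subst (_< j + r) (toℕ-lookup-⊕-↑ʳ i)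
        (proj₁ (stable (j ↑ʳ i)) (subst (_< j + r) (sym (toℕ-↑ʳ j i)) (+-monoʳ-< j i<r))))) ,
      (λ b<r → +-cancelˡ-< j _ _ (subst (_< j + r) (toℕ-↑ʳ j i)
        (proj₂ (stable (j ↑ʳ i)) (subst (_< j + r) (sym (toℕ-lookup-⊕-↑ʳ i)) (+-monoʳ-< j b<r)))))

    ⊕-prefixStable-shift⁺ : (r : ℕ) → PrefixStable (lookup b) r → PrefixStable (lookup (a ⊕ b)) (j + r)
    ⊕-prefixStable-shift⁺ r stable k with split j s k
    ... | left i = (λ _ → <-≤-trans (proj₁ (⊕-prefixStable (i ↑ˡ s)) (toℕ-↑ˡ< i)) (m≤m+n j r)) ,
                   (λ _ → <-≤-trans (toℕ-↑ˡ< i) (m≤m+n j r))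
    ... | right i =
      (λ i<jr → subst (_< j + r) (sym (toℕ-lookup-⊕-↑ʳ i))
        (+-monoʳ-< j (proj₁ (stable i) (+-cancelˡ-< j _ _ (subst (_< j + r) (toℕ-↑ʳ j i) i<jr))))) ,
      (λ b<jr → subst (_< j + r) (sym (toℕ-↑ʳ j i))
        (+-monoʳ-< j (proj₂ (stable i) (+-cancelˡ-< j _ _ (subst (_< j + r) (toℕ-lookup-⊕-↑ʳ i) b<jr)))))

LastCut : {M : ℕ} → Vec (Fin M) M → ℕ → Set
LastCut {M} v j = PrefixStable (lookup v) j × ((t : Fin M) → j < toℕ t → ¬ PrefixStable (lookup v) (toℕ t))

LastCut? : {M : ℕ} (v : Vec (Fin M) M) (j : ℕ) → Dec (LastCut v j)
LastCut? v j = PrefixStable? (lookup v) j ×-dec all? λ t → (j <? toℕ t) →-dec ¬? (PrefixStable? (lookup v) (toℕ t))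

Decomposable : {N : ℕ} → Vec (Fin N) N → Set
Decomposable {N} π = Σ (Fin N) λ r → 1 ≤ toℕ r × PrefixStable (lookup π) (toℕ r)

Decomposable? : {N : ℕ} (π : Vec (Fin N) N) → Dec (Decomposable π)
Decomposable? π = any? λ r → (1 ≤? toℕ r) ×-dec PrefixStable? (lookup π) (toℕ r)

IsC⇒¬Decomposable : {s : ℕ} {b : Vec (Fin s) s} → IsC s b → ¬ Decomposable b
IsC⇒¬Decomposable (perm , no-image) (r , 1≤r , stable) = no-image r 1≤r (PrefixStable⇒ImageIs perm stable)

¬Decomposable⇒IsC : {s : ℕ} {b : Vec (Fin s) s} → IsPerm s b → ¬ Decomposable b → IsC s b
¬Decomposable⇒IsC perm indecomposable = perm , λ r 1≤r image → indecomposable (r , 1≤r , ImageIs⇒PrefixStable perm image)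

module _ {j s : ℕ} (a : Vec (Fin j) j) (b : Vec (Fin s) s) where

  ⊕-lastCut⁺ : ¬ Decomposable b → LastCut (a ⊕ b) j
  ⊕-lastCut⁺ indecomposable = ⊕-prefixStable a b , larger-unstable
    where
    larger-unstable : (t : Fin (j + s)) → j < toℕ t → ¬ PrefixStable (lookup (a ⊕ b)) (toℕ t)
    larger-unstable t j<t stable = indecomposable (fromℕ< r<s ,
      subst (1 ≤_) (sym (toℕ-fromℕ< r<s)) 1≤r ,
      subst (PrefixStable (lookup b)) (sym (toℕ-fromℕ< r<s))
        (⊕-prefixStable-shift⁻ a b r (subst (PrefixStable (lookup (a ⊕ b))) (sym j+r≡t) stable)))
      where
      r : ℕ
      r = toℕ t ∸ j
      j+r≡t : j + r ≡ toℕ t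
      j+r≡t = m+[n∸m]≡n (<⇒≤ j<t)
      r<s : r < s
      r<s = +-cancelˡ-< j _ _ (subst (_< j + s) (sym j+r≡t) (toℕ<n t))
      1≤r : 1 ≤ r
      1≤r = +-cancelˡ-≤ j 1 r (subst (_≤ j + r) (+-comm 1 j) (subst (suc j ≤_) (sym j+r≡t) j<t))

  ⊕-lastCut⁻ : LastCut (a ⊕ b) j → ¬ Decomposable b
  ⊕-lastCut⁻ (_ , larger-unstable) (r , 1≤r , stable) = larger-unstable (fromℕ< j+r<j+s)
    (subst (j <_) (sym (toℕ-fromℕ< j+r<j+s)) (subst (_≤ j + toℕ r) (+-comm j 1) (+-monoʳ-≤ j 1≤r)))
    (subst (PrefixStable (lookup (a ⊕ b))) (sym (toℕ-fromℕ< j+r<j+s)) (⊕-prefixStable-shift⁺ a b (toℕ r) stable))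
    where
    j+r<j+s : j + toℕ r < j + s
    j+r<j+s = +-monoʳ-< j (toℕ<n r)

-- A permutation whose last cut is j is a ⊕ b for a permutation a of j points and an indecomposable b.
card-LastCut : (j s : ℕ) → Card (IsPerm (j + s) ∩ λ v → LastCut v j) (j ! * c s)
card-LastCut j s = subst (Card (IsPerm (j + s) ∩ λ v → LastCut v j)) count
  (card-filter (λ v → IsPerm? (j + s) v ×-dec LastCut? v j))
  where
  decompose : InjectionOn (IsPerm (j + s) ∩ λ v → LastCut v j) (IsPerm j ⟨×⟩ IsC s)
  decompose = record
    { to = λ v → restrictˡ v , restrictʳ v
    ; to-∈ = λ {v} (perm , lastCut) →
        let v≡a⊕b = sym (⊕-restrict v (proj₁ lastCut))
            (a-perm , b-perm) = ⊕-perm⁻ (restrictˡ v) (restrictʳ v) (subst (IsPerm (j + s)) v≡a⊕b perm)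
        in a-perm , ¬Decomposable⇒IsC {b = restrictʳ v} b-perm (⊕-lastCut⁻ (restrictˡ v) (restrictʳ v) (subst (λ w → LastCut w j) v≡a⊕b lastCut))
    ; injective = λ {v} {v′} (_ , lastCut) (_ , lastCut′) eq →
        trans (sym (⊕-restrict v (proj₁ lastCut)))
          (trans (cong (λ (a , b) → a ⊕ b) eq) (⊕-restrict v′ (proj₁ lastCut′)))
    }
  compose : InjectionOn (IsPerm j ⟨×⟩ IsC s) (IsPerm (j + s) ∩ λ v → LastCut v j)
  compose = record
    { to = λ (a , b) → a ⊕ b
    ; to-∈ = λ { {a , b} (a-perm , b-isC) → ⊕-perm⁺ a b a-perm (proj₁ b-isC) , ⊕-lastCut⁺ a b (IsC⇒¬Decomposable {b = b} b-isC) }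
    ; injective = λ _ _ → ⊕-injective
    }
  count : length (filter (λ v → IsPerm? (j + s) v ×-dec LastCut? v j) (allVecs (j + s) (j + s))) ≡ j ! * c s
  count = card-≡ (card-filter _) (card-⟨×⟩ (card-IsPerm j) (card-filter (IsC? s))) decompose compose

LastCut-unique : {M j j′ : ℕ} (v : Vec (Fin M) M) → j < M → j′ < M → LastCut v j → LastCut v j′ → j ≡ j′
LastCut-unique v j<M j′<M (stable , maximal) (stable′ , maximal′) with <-cmp _ _
... | tri≈ _ j≡j′ _ = j≡j′
... | tri< j<j′ _ _ = ⊥-elim (maximal (fromℕ< j′<M) (subst (_ <_) (sym (toℕ-fromℕ< j′<M)) j<j′)
                        (subst (PrefixStable (lookup v)) (sym (toℕ-fromℕ< j′<M)) stable′))
... | tri> _ _ j′<j = ⊥-elim (maximal′ (fromℕ< j<M) (subst (_ <_) (sym (toℕ-fromℕ< j<M)) j′<j)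
                        (subst (PrefixStable (lookup v)) (sym (toℕ-fromℕ< j<M)) stable))

largestStable≤ : {M : ℕ} (v : Vec (Fin M) M) (B : ℕ) →
  Σ ℕ λ j → j ≤ B × PrefixStable (lookup v) j ×
    ((t : Fin M) → j < toℕ t → toℕ t ≤ B → ¬ PrefixStable (lookup v) (toℕ t))
largestStable≤ v zero = 0 , z≤n , (λ _ → (λ ()) , (λ ())) , λ _ j<t t≤0 _ → <⇒≱ j<t t≤0
largestStable≤ {M} v (suc B) with PrefixStable? (lookup v) (suc B)
... | yes stable = suc B , ≤-refl , stable , λ _ j<t t≤j _ → <⇒≱ j<t t≤j
... | no unstable with largestStable≤ v B
...   | j , j≤B , stable , maximal = j , m≤n⇒m≤1+n j≤B , stable , maximal′
  where
  maximal′ : (t : Fin M) → j < toℕ t → toℕ t ≤ suc B → ¬ PrefixStable (lookup v) (toℕ t)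
  maximal′ t j<t t≤1+B with m≤n⇒m<n∨m≡n t≤1+B
  ... | inj₁ (s≤s t≤B) = maximal t j<t t≤B
  ... | inj₂ t≡1+B = subst (λ r → ¬ PrefixStable (lookup v) r) (sym t≡1+B) unstable

lastCut-exists : {m : ℕ} (v : Vec (Fin (suc m)) (suc m)) → ∃ λ j → j < suc m × LastCut v j
lastCut-exists {m} v with largestStable≤ v m
... | j , j≤m , stable , maximal = j , s≤s j≤m , stable , λ t j<t → maximal t j<t (≤-pred (toℕ<n t))

LastCutBelow : (M B : ℕ) → Pred (Vec (Fin M) M) 0ℓ
LastCutBelow M B v = IsPerm M v × ∃ λ j → j < B × LastCut v j

card-LastCutBelow : (M B : ℕ) → B ≤ M → Card (LastCutBelow M B) (Σ< B λ j → j ! * c (M ∸ j))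
card-LastCutBelow M zero _ = [] , [] , (λ v → (λ ()) , (λ { (_ , _ , () , _) })) , refl
card-LastCutBelow M (suc B) B<M =
  card-cong (card-∪ (card-LastCutBelow M B (<⇒≤ B<M)) card-B (λ {v} → disjoint {v})) ((λ {v} → merge {v}) , λ {v} → unmerge {v})
  where
  LastCutAtB : Pred (Vec (Fin M) M) 0ℓ
  LastCutAtB = IsPerm M ∩ λ v → LastCut v B
  card-B : Card LastCutAtB (B ! * c (M ∸ B))
  card-B = subst (λ N → Card (IsPerm N ∩ λ v → LastCut v B) (B ! * c (M ∸ B))) (m+[n∸m]≡n (<⇒≤ B<M))
    (card-LastCut B (M ∸ B))
  disjoint : ∀ {v} → LastCutBelow M B v → LastCutAtB v → ⊥
  disjoint {v} (_ , j , j<B , lastCut) (_ , lastCut-B) with LastCut-unique v (<-trans j<B B<M) B<M lastCut lastCut-B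
  ... | refl = <-irrefl refl j<B
  merge : (LastCutBelow M B ∪ LastCutAtB) ⊆ LastCutBelow M (suc B)
  merge {v} (inj₁ (perm , j , j<B , lastCut)) = perm , j , m≤n⇒m≤1+n j<B , lastCut
  merge {v} (inj₂ (perm , lastCut)) = perm , B , ≤-refl , lastCut
  unmerge : LastCutBelow M (suc B) ⊆ (LastCutBelow M B ∪ LastCutAtB)
  unmerge {v} (perm , j , j<1+B , lastCut) with m≤n⇒m<n∨m≡n j<1+B
  ... | inj₁ (s≤s j<B) = inj₁ (perm , j , j<B , lastCut)
  ... | inj₂ refl = inj₂ (perm , lastCut)

factorial-recurrence : (M : ℕ) → 1 ≤ M → Σ< M (λ j → j ! * c (M ∸ j)) ≡ M !
factorial-recurrence (suc m) _ = card-unique (card-LastCutBelow (suc m) (suc m) ≤-refl) (card-IsPerm (suc m))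
  ((λ {v} → proj₁) , λ {v} perm → perm , lastCut-exists v)

-- Decomposable and skew-decomposable permutations

complement : {N : ℕ} → Vec (Fin N) N → Vec (Fin N) N
complement π = mapᵥ opposite π

complement-involutive : {N : ℕ} (π : Vec (Fin N) N) → complement (complement π) ≡ π
complement-involutive π = lookup-extensionality _ π λ i →
  trans (lookup-map i opposite (complement π)) (trans (cong opposite (lookup-map i opposite π)) (opposite-involutive _))

complement-perm : {N : ℕ} {π : Vec (Fin N) N} → IsPerm N π → IsPerm N (complement π)
complement-perm {π = π} (injective , surjective) =
  (λ i j eq → injective i j (opposite-injective (trans (sym (lookup-map i opposite π)) (trans eq (lookup-map j opposite π))))) ,
  (λ y → let (x , eq) = surjective (opposite y) in
         x , trans (lookup-map x opposite π) (trans (cong opposite eq) (opposite-involutive y)))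
  where
  opposite-injective : ∀ {x y : Fin _} → opposite x ≡ opposite y → x ≡ y
  opposite-injective {x} {y} eq = trans (sym (opposite-involutive x)) (trans (cong opposite eq) (opposite-involutive y))

toℕ-lookup-complement : {N : ℕ} (π : Vec (Fin N) N) (i : Fin N) → toℕ (lookup (complement π) i) ≡ N ∸ suc (toℕ (lookup π i))
toℕ-lookup-complement π i = trans (cong toℕ (lookup-map i opposite π)) (opposite-prop _)

-- If π fixes a prefix of length r ≥ 1, the preimage of 0 lies in it, so the complement sends a point
-- of any prefix of length r′ ≥ r to N - 1 and cannot fix that prefix.
stable⇒complement-unstable : {N : ℕ} {π : Vec (Fin N) N} {r r′ : Fin N} → IsPerm N π → 1 ≤ toℕ r → toℕ r ≤ toℕ r′ →
  PrefixStable (lookup π) (toℕ r) → ¬ PrefixStable (lookup (complement π)) (toℕ r′)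
stable⇒complement-unstable {suc M} {π} {r} {r′} (_ , surjective) 1≤r r≤r′ stable stable′ =
  <⇒≱ (proj₁ (stable′ a) (<-≤-trans a<r r≤r′)) (subst (toℕ r′ ≤_) (sym a↦M) (≤-pred (toℕ<n r′)))
  where
  a : Fin (suc M)
  a = proj₁ (surjective zero)
  a<r : toℕ a < toℕ r
  a<r = proj₂ (stable a) (subst (λ y → toℕ y < toℕ r) (sym (proj₂ (surjective zero))) 1≤r)
  a↦M : toℕ (lookup (complement π) a) ≡ M
  a↦M = trans (toℕ-lookup-complement π a) (cong (λ y → M ∸ toℕ y) (proj₂ (surjective zero)))

complement-disjoint : {N : ℕ} {π : Vec (Fin N) N} → IsPerm N π → Decomposable π → ¬ Decomposable (complement π)
complement-disjoint {π = π} perm (r , 1≤r , stable) (r′ , 1≤r′ , stable′) with ≤-total (toℕ r) (toℕ r′)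
... | inj₁ r≤r′ = stable⇒complement-unstable {π = π} perm 1≤r r≤r′ stable stable′
... | inj₂ r′≤r = stable⇒complement-unstable {π = complement π} (complement-perm {π = π} perm) 1≤r′ r′≤r stable′
                    (subst (λ σ → PrefixStable (lookup σ) (toℕ r)) (sym (complement-involutive π)) stable)

decomposables : ℕ → ℕ
decomposables N = length (filter (λ π → IsPerm? N π ×-dec Decomposable? π) (allVecs N N))

BothIndecomposable : (N : ℕ) → Pred (Vec (Fin N) N) 0ℓ
BothIndecomposable N π = IsPerm N π × ¬ Decomposable π × ¬ Decomposable (complement π)

BothIndecomposable? : (N : ℕ) → Decidable (BothIndecomposable N)
BothIndecomposable? N π = IsPerm? N π ×-dec ¬? (Decomposable? π) ×-dec ¬? (Decomposable? (complement π))

bothIndecomposables : ℕ → ℕ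
bothIndecomposables N = length (filter (BothIndecomposable? N) (allVecs N N))

card-skewDecomposable : (N : ℕ) → Card (IsPerm N ∩ λ π → Decomposable (complement π)) (decomposables N)
card-skewDecomposable N = subst (Card SkewDecomposablePerm) (sym (card-≡ (card-filter _) (card-filter _) to-skew from-skew))
  (card-filter λ π → IsPerm? N π ×-dec Decomposable? (complement π))
  where
  SkewDecomposablePerm : Pred (Vec (Fin N) N) 0ℓ
  SkewDecomposablePerm = IsPerm N ∩ λ π → Decomposable (complement π)
  to-skew : InjectionOn (IsPerm N ∩ Decomposable) (IsPerm N ∩ λ π → Decomposable (complement π))
  to-skew = involution-injectionOn complement complement-involutive λ {π} (perm , decomposable) →
    complement-perm {π = π} perm , subst Decomposable (sym (complement-involutive π)) decomposable
  from-skew : InjectionOn (IsPerm N ∩ λ π → Decomposable (complement π)) (IsPerm N ∩ Decomposable)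
  from-skew = involution-injectionOn complement complement-involutive λ {π} (perm , skew) →
    complement-perm {π = π} perm , skew

c+decomposables≡! : (N : ℕ) → c N + decomposables N ≡ N !
c+decomposables≡! N = card-unique (card-∪ (card-filter (IsC? N)) (card-filter _) (λ {π} → disjoint {π})) (card-IsPerm N)
  ((λ { {π} (inj₁ isC) → proj₁ isC ; (inj₂ (perm , _)) → perm }) , λ {π} → split-by-decomposability {π})
  where
  disjoint : ∀ {π} → IsC N π → (IsPerm N ∩ Decomposable) π → ⊥
  disjoint {π} isC (_ , decomposable) = IsC⇒¬Decomposable {b = π} isC decomposable
  split-by-decomposability : ∀ {π} → IsPerm N π → (IsC N ∪ (IsPerm N ∩ Decomposable)) π
  split-by-decomposability {π} perm with Decomposable? π
  ... | yes decomposable = inj₂ (perm , decomposable)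
  ... | no indecomposable = inj₁ (¬Decomposable⇒IsC {b = π} perm indecomposable)

bothIndecomposables+2*decomposables≡! : (N : ℕ) → bothIndecomposables N + 2 * decomposables N ≡ N !
bothIndecomposables+2*decomposables≡! N =
  trans (cong (λ x → bothIndecomposables N + (decomposables N + x)) (+-identityʳ (decomposables N)))
    (card-unique (card-∪ (card-filter (BothIndecomposable? N)) (card-∪ (card-filter _) (card-skewDecomposable N)
                   (λ {π} → disjoint-skew {π}))
                   (λ {π} → disjoint {π}))
                 (card-IsPerm N) ((λ {π} → permutation {π}) , λ {π} → classify {π}))
  where
  Classified : Pred (Vec (Fin N) N) 0ℓ
  Classified = BothIndecomposable N ∪ ((IsPerm N ∩ Decomposable) ∪ (IsPerm N ∩ λ π → Decomposable (complement π)))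
  disjoint-skew : ∀ {π} → (IsPerm N ∩ Decomposable) π → (IsPerm N ∩ λ π → Decomposable (complement π)) π → ⊥
  disjoint-skew {π} (perm , decomposable) (_ , skew) = complement-disjoint {π = π} perm decomposable skew
  disjoint : ∀ {π} → BothIndecomposable N π → ((IsPerm N ∩ Decomposable) ∪ (IsPerm N ∩ λ π → Decomposable (complement π))) π → ⊥
  disjoint (_ , indecomposable , _) (inj₁ (_ , decomposable)) = indecomposable decomposable
  disjoint (_ , _ , skew-indecomposable) (inj₂ (_ , skew)) = skew-indecomposable skew
  permutation : Classified ⊆ IsPerm N
  permutation (inj₁ (perm , _)) = perm
  permutation (inj₂ (inj₁ (perm , _))) = perm
  permutation (inj₂ (inj₂ (perm , _))) = perm
  classify : IsPerm N ⊆ Classified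
  classify {π} perm with Decomposable? π | Decomposable? (complement π)
  ... | yes decomposable | _ = inj₂ (inj₁ (perm , decomposable))
  ... | no _ | yes skew = inj₂ (inj₂ (perm , skew))
  ... | no indecomposable | no skew-indecomposable = inj₁ (perm , indecomposable , skew-indecomposable)

-- Leaf sets as prefixes and suffixes

prefix-injection-≤ : {N s s′ : ℕ} (g : Fin N → Fin N) → (∀ {x y} → g x ≡ g y → x ≡ y) → s ≤ N →
  (∀ q → toℕ q < s → toℕ (g q) < s′) → s ≤ s′
prefix-injection-≤ {N} {s} {s′} g g-injective s≤N maps = injective⇒≤ {f = h} h-injective
  where
  embed : Fin s → Fin N
  embed i = inject≤ i s≤N
  embed<s : ∀ i → toℕ (embed i) < s
  embed<s i = subst (_< s) (sym (toℕ-inject≤ i s≤N)) (toℕ<n i)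
  h : Fin s → Fin s′
  h i = fromℕ< (maps (embed i) (embed<s i))
  h-injective : ∀ {i j} → h i ≡ h j → i ≡ j
  h-injective {i} {j} eq = toℕ-injective (trans (sym (toℕ-inject≤ i s≤N)) (trans (cong toℕ embed-eq) (toℕ-inject≤ j s≤N)))
    where
    embed-eq : embed i ≡ embed j
    embed-eq = g-injective (toℕ-injective (fromℕ<-injective _ _ _ _ eq))

data Shape : Set where
  prefix suffix : ℕ → Shape

infix 4 _∈ₛ_

_∈ₛ_ : ℕ → Shape → Set
q ∈ₛ prefix s = q < s
q ∈ₛ suffix r = r ≤ q

∁ₛ : Shape → Shape
∁ₛ (prefix s) = suffix s
∁ₛ (suffix r) = prefix r

Matches : {N : ℕ} → Shape → Shape → (Fin N → Fin N) → Set
Matches {N} S₁ S₂ f = (q : Fin N) → (toℕ q ∈ₛ S₁ → toℕ (f q) ∈ₛ S₂) × (toℕ (f q) ∈ₛ S₂ → toℕ q ∈ₛ S₁)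

∈ₛ-∁ₛ : (S : Shape) (q : ℕ) → (q ∈ₛ ∁ₛ S → ¬ q ∈ₛ S) × (¬ q ∈ₛ S → q ∈ₛ ∁ₛ S)
∈ₛ-∁ₛ (prefix s) q = (λ s≤q q<s → <⇒≱ q<s s≤q) , ≮⇒≥
∈ₛ-∁ₛ (suffix r) q = (λ q<r r≤q → <⇒≱ q<r r≤q) , ≰⇒>

Matches-∁ₛ : {N : ℕ} {f : Fin N → Fin N} (S₁ S₂ : Shape) → Matches S₁ S₂ f → Matches (∁ₛ S₁) (∁ₛ S₂) f
Matches-∁ₛ S₁ S₂ matches q =
  (λ q∈ → proj₂ (∈ₛ-∁ₛ S₂ _) λ fq∈ → proj₁ (∈ₛ-∁ₛ S₁ _) q∈ (proj₂ (matches q) fq∈)) ,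
  (λ fq∈ → proj₂ (∈ₛ-∁ₛ S₁ _) λ q∈ → proj₁ (∈ₛ-∁ₛ S₂ _) fq∈ (proj₁ (matches q) q∈))

matched-prefixes-equal : {N s s′ : ℕ} {f : Fin N → Fin N} → IsBij f → s ≤ N → s′ ≤ N →
  Matches (prefix s) (prefix s′) f → s ≡ s′
matched-prefixes-equal {N} {s} {s′} {f} (injective , surjective) s≤N s′≤N matches =
  ≤-antisym (prefix-injection-≤ f (injective _ _) s≤N (λ q → proj₁ (matches q)))
            (prefix-injection-≤ f⁻¹ f⁻¹-injective s′≤N λ y y<s′ → proj₂ (matches (f⁻¹ y)) (subst (λ z → toℕ z < s′) (sym (f∘f⁻¹ y)) y<s′))
  where
  f⁻¹ : Fin N → Fin N
  f⁻¹ y = proj₁ (surjective y)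
  f∘f⁻¹ : ∀ y → f (f⁻¹ y) ≡ y
  f∘f⁻¹ y = proj₂ (surjective y)
  f⁻¹-injective : ∀ {x y} → f⁻¹ x ≡ f⁻¹ y → x ≡ y
  f⁻¹-injective {x} {y} eq = trans (sym (f∘f⁻¹ x)) (trans (cong f eq) (f∘f⁻¹ y))

suffix⇔opposite-prefix : {N r : ℕ} (y : Fin N) → r ≤ N → (r ≤ toℕ y → toℕ (opposite y) < N ∸ r) × (toℕ (opposite y) < N ∸ r → r ≤ toℕ y)
suffix⇔opposite-prefix {N} {r} y r≤N =
  (λ r≤y → subst (_< N ∸ r) (sym (opposite-prop y)) (∸-monoʳ-< (s≤s r≤y) (toℕ<n y))) ,
  (λ y′<N-r → s≤s⁻¹ (∸-cancelʳ-< {o = N} (subst (_< N ∸ r) (opposite-prop y) y′<N-r)))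

Matches-suffix⇔complement-prefix : {N r : ℕ} (π : Vec (Fin N) N) (S : Shape) → r ≤ N →
  (Matches S (suffix r) (lookup π) → Matches S (prefix (N ∸ r)) (lookup (complement π))) ×
  (Matches S (prefix (N ∸ r)) (lookup (complement π)) → Matches S (suffix r) (lookup π))
Matches-suffix⇔complement-prefix {N} {r} π S r≤N =
  (λ matches q → (λ q∈ → to (proj₁ (matches q) q∈)) , (λ fq∈ → proj₂ (matches q) (from fq∈))) ,
  (λ matches q → (λ q∈ → from (proj₁ (matches q) q∈)) , (λ fq∈ → proj₂ (matches q) (to fq∈)))
  where
  to : ∀ {q} → r ≤ toℕ (lookup π q) → toℕ (lookup (complement π) q) < N ∸ r
  to {q} = subst (_< N ∸ r) (sym (cong toℕ (lookup-map q opposite π))) ∘ proj₁ (suffix⇔opposite-prefix (lookup π q) r≤N)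
  from : ∀ {q} → toℕ (lookup (complement π) q) < N ∸ r → r ≤ toℕ (lookup π q)
  from {q} = proj₂ (suffix⇔opposite-prefix (lookup π q) r≤N) ∘ subst (_< N ∸ r) (cong toℕ (lookup-map q opposite π))

ValidShape : ℕ → Shape → Set
ValidShape k (prefix s) = 1 ≤ s × s ≤ k
ValidShape k (suffix r) = k ≤ r × r < k + k

ShapeMatched : (k : ℕ) → Vec (Fin (k + k)) (k + k) → Set
ShapeMatched k π = Σ Shape λ S₁ → Σ Shape λ S₂ → ValidShape k S₁ × ValidShape k S₂ × Matches S₁ S₂ (lookup π)

decomposable-at : {N s : ℕ} {π : Vec (Fin N) N} → 1 ≤ s → s < N → PrefixStable (lookup π) s → Decomposable π
decomposable-at {π = π} 1≤s s<N stable =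
  fromℕ< s<N , subst (1 ≤_) (sym (toℕ-fromℕ< s<N)) 1≤s , subst (PrefixStable (lookup π)) (sym (toℕ-fromℕ< s<N)) stable

complement-stable⇒Matches : {N r : ℕ} (π : Vec (Fin N) N) → r ≤ N →
  PrefixStable (lookup (complement π)) r → Matches (prefix r) (suffix (N ∸ r)) (lookup π)
complement-stable⇒Matches {N} {r} π r≤N stable = proj₂ (Matches-suffix⇔complement-prefix π (prefix r) (m∸n≤m N r))
  (subst (λ x → Matches (prefix r) (prefix x) (lookup (complement π))) (sym (m∸[m∸n]≡n r≤N)) stable)

module _ (k : ℕ) (π : Vec (Fin (k + k)) (k + k)) where

  private
    N : ℕ
    N = k + k

    prefix<N : {s : ℕ} → ValidShape k (prefix s) → s < N
    prefix<N (1≤s , s≤k) = ≤-<-trans s≤k (m<m+n k (≤-trans 1≤s s≤k))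

    1≤suffix : {r : ℕ} → ValidShape k (suffix r) → 1 ≤ r
    1≤suffix {zero} (k≤0 , 0<k+k) = ⊥-elim (<⇒≱ 0<k+k (subst (k + k ≤_) (+-identityʳ 0) (+-mono-≤ k≤0 k≤0)))
    1≤suffix {suc r} _ = s≤s z≤n

  ShapeMatched⇒decomposable : IsPerm N π → ShapeMatched k π → Decomposable π ⊎ Decomposable (complement π)
  ShapeMatched⇒decomposable perm (prefix s , prefix s′ , valid@(1≤s , s≤k) , (_ , s′≤k) , matches)
    with matched-prefixes-equal perm (<⇒≤ (prefix<N valid)) (≤-trans s′≤k (m≤m+n k k)) matches
  ... | refl = inj₁ (decomposable-at {π = π} 1≤s (prefix<N valid) matches)
  ShapeMatched⇒decomposable perm (suffix r , suffix r′ , valid@(_ , r<N) , (_ , r′<N) , matches)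
    with matched-prefixes-equal perm (<⇒≤ r<N) (<⇒≤ r′<N) (Matches-∁ₛ (suffix r) (suffix r′) matches)
  ... | refl = inj₁ (decomposable-at {π = π} (1≤suffix valid) r<N (Matches-∁ₛ (suffix r) (suffix r) matches))
  ShapeMatched⇒decomposable perm (prefix s , suffix r′ , valid@(1≤s , s≤k) , (_ , r′<N) , matches) =
    inj₂ (decomposable-at {π = complement π} 1≤s (prefix<N valid)
      (subst (λ x → Matches (prefix s) (prefix x) (lookup (complement π))) (sym s≡N-r′) matches′))
    where
    matches′ : Matches (prefix s) (prefix (N ∸ r′)) (lookup (complement π))
    matches′ = proj₁ (Matches-suffix⇔complement-prefix π (prefix s) (<⇒≤ r′<N)) matches
    s≡N-r′ : s ≡ N ∸ r′
    s≡N-r′ = matched-prefixes-equal (complement-perm {π = π} perm) (<⇒≤ (prefix<N valid)) (m∸n≤m N r′) matches′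
  ShapeMatched⇒decomposable perm (suffix r , prefix s′ , valid@(_ , r<N) , (_ , s′≤k) , matches) =
    inj₂ (decomposable-at {π = complement π} (1≤suffix valid) r<N
      (subst (λ x → Matches (prefix r) (prefix x) (lookup (complement π))) (sym r≡N-s′) matches′))
    where
    matches′ : Matches (prefix r) (prefix (N ∸ s′)) (lookup (complement π))
    matches′ = proj₁ (Matches-suffix⇔complement-prefix π (prefix r) (≤-trans s′≤k (m≤m+n k k)))
                 (Matches-∁ₛ (suffix r) (prefix s′) matches)
    r≡N-s′ : r ≡ N ∸ s′
    r≡N-s′ = matched-prefixes-equal (complement-perm {π = π} perm) (<⇒≤ r<N) (m∸n≤m N s′) matches′

  decomposable⇒ShapeMatched : Decomposable π ⊎ Decomposable (complement π) → ShapeMatched k π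
  decomposable⇒ShapeMatched (inj₁ (r , 1≤r , stable)) with ≤-<-connex (toℕ r) k
  ... | inj₁ r≤k = prefix (toℕ r) , prefix (toℕ r) , (1≤r , r≤k) , (1≤r , r≤k) , stable
  ... | inj₂ k<r = suffix (toℕ r) , suffix (toℕ r) , (<⇒≤ k<r , toℕ<n r) , (<⇒≤ k<r , toℕ<n r) ,
                   Matches-∁ₛ (prefix (toℕ r)) (prefix (toℕ r)) stable
  decomposable⇒ShapeMatched (inj₂ (r , 1≤r , stable)) with ≤-<-connex (toℕ r) k
  ... | inj₁ r≤k = prefix (toℕ r) , suffix (N ∸ toℕ r) , (1≤r , r≤k) ,
                   (subst (_≤ N ∸ toℕ r) (m+n∸m≡n k k) (∸-monoʳ-≤ N r≤k) , ∸-monoʳ-< 1≤r (<⇒≤ (toℕ<n r))) ,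
                   complement-stable⇒Matches π (<⇒≤ (toℕ<n r)) stable
  ... | inj₂ k<r = suffix (toℕ r) , prefix (N ∸ toℕ r) , (<⇒≤ k<r , toℕ<n r) ,
                   (m<n⇒0<n∸m (toℕ<n r) , subst (N ∸ toℕ r ≤_) (m+n∸m≡n k k) (∸-monoʳ-≤ N (<⇒≤ k<r))) ,
                   Matches-∁ₛ (prefix (toℕ r)) (suffix (N ∸ toℕ r)) (complement-stable⇒Matches π (<⇒≤ (toℕ<n r)) stable)

-- The tree d(k,k) and its glued graph

module DoubleArm (n : ℕ) where

  k : ℕ
  k = suc n

  t : RTree
  t = d₊ n n

  Vertex Edge ArmVertex : Set
  Vertex = IV t
  Edge = IE t
  ArmVertex = Fin k ⊎ Fin k

  parentᵥ : ArmVertex → Vertex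
  parentᵥ (inj₁ zero) = inj₁ tt
  parentᵥ (inj₁ (suc p)) = inj₂ (inj₁ (inject₁ p))
  parentᵥ (inj₂ zero) = inj₁ tt
  parentᵥ (inj₂ (suc p)) = inj₂ (inj₂ (inject₁ p))

  lowerEnd : Edge → ArmVertex
  lowerEnd (inj₁ true) = inj₁ zero
  lowerEnd (inj₁ false) = inj₂ zero
  lowerEnd (inj₂ (inj₁ p)) = inj₁ (suc p)
  lowerEnd (inj₂ (inj₂ p)) = inj₂ (suc p)

  edgeAbove : ArmVertex → Edge
  edgeAbove (inj₁ zero) = inj₁ true
  edgeAbove (inj₁ (suc p)) = inj₂ (inj₁ p)
  edgeAbove (inj₂ zero) = inj₁ false
  edgeAbove (inj₂ (suc p)) = inj₂ (inj₂ p)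

  ends≡ : (x : Edge) → ends t x ≡ (parentᵥ (lowerEnd x) , inj₂ (lowerEnd x))
  ends≡ (inj₁ true) = refl
  ends≡ (inj₁ false) = refl
  ends≡ (inj₂ (inj₁ p)) = refl
  ends≡ (inj₂ (inj₂ p)) = refl

  edgeAbove-lowerEnd : (x : Edge) → edgeAbove (lowerEnd x) ≡ x
  edgeAbove-lowerEnd (inj₁ true) = refl
  edgeAbove-lowerEnd (inj₁ false) = refl
  edgeAbove-lowerEnd (inj₂ (inj₁ p)) = refl
  edgeAbove-lowerEnd (inj₂ (inj₂ p)) = refl

  lowerEnd-edgeAbove : (a : ArmVertex) → lowerEnd (edgeAbove a) ≡ a
  lowerEnd-edgeAbove (inj₁ zero) = refl
  lowerEnd-edgeAbove (inj₁ (suc p)) = refl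
  lowerEnd-edgeAbove (inj₂ zero) = refl
  lowerEnd-edgeAbove (inj₂ (suc p)) = refl

  infix 4 _≼_ _≼?_

  _≼_ : Vertex → Vertex → Set
  inj₁ _ ≼ _ = ⊤
  inj₂ (inj₁ x) ≼ inj₂ (inj₁ y) = toℕ x ≤ toℕ y
  inj₂ (inj₂ x) ≼ inj₂ (inj₂ y) = toℕ x ≤ toℕ y
  inj₂ (inj₁ _) ≼ inj₁ _ = ⊥
  inj₂ (inj₁ _) ≼ inj₂ (inj₂ _) = ⊥
  inj₂ (inj₂ _) ≼ inj₁ _ = ⊥
  inj₂ (inj₂ _) ≼ inj₂ (inj₁ _) = ⊥

  _≼?_ : (v w : Vertex) → Dec (v ≼ w)
  inj₁ _ ≼? _ = yes tt
  inj₂ (inj₁ x) ≼? inj₂ (inj₁ y) = toℕ x ≤? toℕ y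
  inj₂ (inj₂ x) ≼? inj₂ (inj₂ y) = toℕ x ≤? toℕ y
  inj₂ (inj₁ _) ≼? inj₁ _ = no λ ()
  inj₂ (inj₁ _) ≼? inj₂ (inj₂ _) = no λ ()
  inj₂ (inj₂ _) ≼? inj₁ _ = no λ ()
  inj₂ (inj₂ _) ≼? inj₂ (inj₁ _) = no λ ()

  Below : Edge → Vertex → Set
  Below e w = inj₂ (lowerEnd e) ≼ w

  Below? : (e : Edge) (w : Vertex) → Dec (Below e w)
  Below? e w = inj₂ (lowerEnd e) ≼? w

  root-not-Below : (e : Edge) → ¬ Below e (inj₁ tt)
  root-not-Below (inj₁ true) ()
  root-not-Below (inj₁ false) ()
  root-not-Below (inj₂ (inj₁ _)) ()
  root-not-Below (inj₂ (inj₂ _)) ()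

  ≼-parentᵥ : (v a : ArmVertex) → v ≢ a → (inj₂ v ≼ parentᵥ a → inj₂ v ≼ inj₂ a) × (inj₂ v ≼ inj₂ a → inj₂ v ≼ parentᵥ a)
  ≼-parentᵥ (inj₁ x) (inj₁ zero) x≢0 = (λ ()) , λ x≤0 → ⊥-elim (x≢0 (cong inj₁ (toℕ-injective (n≤0⇒n≡0 x≤0))))
  ≼-parentᵥ (inj₁ x) (inj₁ (suc p)) x≢p+1 =
    (λ x≤p → m≤n⇒m≤1+n (subst (toℕ x ≤_) (toℕ-inject₁ p) x≤p)) ,
    (λ x≤p+1 → subst (toℕ x ≤_) (sym (toℕ-inject₁ p)) (s≤s⁻¹ (≤∧≢⇒< x≤p+1 (x≢p+1 ∘ cong inj₁ ∘ toℕ-injective))))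
  ≼-parentᵥ (inj₂ y) (inj₂ zero) y≢0 = (λ ()) , λ y≤0 → ⊥-elim (y≢0 (cong inj₂ (toℕ-injective (n≤0⇒n≡0 y≤0))))
  ≼-parentᵥ (inj₂ y) (inj₂ (suc p)) y≢p+1 =
    (λ y≤p → m≤n⇒m≤1+n (subst (toℕ y ≤_) (toℕ-inject₁ p) y≤p)) ,
    (λ y≤p+1 → subst (toℕ y ≤_) (sym (toℕ-inject₁ p)) (s≤s⁻¹ (≤∧≢⇒< y≤p+1 (y≢p+1 ∘ cong inj₂ ∘ toℕ-injective))))
  ≼-parentᵥ (inj₁ _) (inj₂ zero) _ = (λ ()) , (λ ())
  ≼-parentᵥ (inj₁ _) (inj₂ (suc _)) _ = (λ ()) , (λ ())
  ≼-parentᵥ (inj₂ _) (inj₁ zero) _ = (λ ()) , (λ ())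
  ≼-parentᵥ (inj₂ _) (inj₁ (suc _)) _ = (λ ()) , (λ ())

  Below-ends : (e x : Edge) → x ≢ e →
    (Below e (proj₁ (ends t x)) → Below e (proj₂ (ends t x))) × (Below e (proj₂ (ends t x)) → Below e (proj₁ (ends t x)))
  Below-ends e x x≢e rewrite ends≡ x = ≼-parentᵥ (lowerEnd e) (lowerEnd x) lowerEnds≢
    where
    lowerEnds≢ : lowerEnd e ≢ lowerEnd x
    lowerEnds≢ eq = x≢e (trans (sym (edgeAbove-lowerEnd x)) (trans (cong edgeAbove (sym eq)) (edgeAbove-lowerEnd e)))

  -- Leaf positions: the left leaves in reverse order, then the right leaves, so that the leaves
  -- below any internal edge occupy a prefix or a suffix.
  position : Fin (k + k) → Fin (k + k)
  position u with splitAt k u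
  ... | inj₁ x = opposite x ↑ˡ k
  ... | inj₂ y = k ↑ʳ y

  position-↑ˡ : (x : Fin k) → position (x ↑ˡ k) ≡ opposite x ↑ˡ k
  position-↑ˡ x rewrite splitAt-↑ˡ k x k = refl

  position-↑ʳ : (y : Fin k) → position (k ↑ʳ y) ≡ k ↑ʳ y
  position-↑ʳ y rewrite splitAt-↑ʳ k k y = refl

  parent-↑ˡ : (x : Fin k) → parent t (x ↑ˡ k) ≡ inj₂ (inj₁ x)
  parent-↑ˡ x rewrite splitAt-↑ˡ k x k = refl

  parent-↑ʳ : (y : Fin k) → parent t (k ↑ʳ y) ≡ inj₂ (inj₂ y)
  parent-↑ʳ y rewrite splitAt-↑ʳ k k y = refl

  position-involutive : (u : Fin (k + k)) → position (position u) ≡ u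
  position-involutive u with split k k u
  ... | left x = trans (cong position (position-↑ˡ x))
                   (trans (position-↑ˡ (opposite x)) (cong (_↑ˡ k) (opposite-involutive x)))
  ... | right y = trans (cong position (position-↑ʳ y)) (position-↑ʳ y)

  shapeBelow : ArmVertex → Shape
  shapeBelow (inj₁ x₀) = prefix (k ∸ toℕ x₀)
  shapeBelow (inj₂ y₀) = suffix (k + toℕ y₀)

  shapeOf : Edge → Shape
  shapeOf e = shapeBelow (lowerEnd e)

  ≼-parent⇔position∈ₛ : (a : ArmVertex) (u : Fin (k + k)) →
    (inj₂ a ≼ parent t u → toℕ (position u) ∈ₛ shapeBelow a) × (toℕ (position u) ∈ₛ shapeBelow a → inj₂ a ≼ parent t u)
  ≼-parent⇔position∈ₛ a u with split k k u
  ... | left x rewrite parent-↑ˡ x | position-↑ˡ x | toℕ-↑ˡ (opposite x) k = left-leaf a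
    where
    left-leaf : (a : ArmVertex) → (inj₂ a ≼ inj₂ (inj₁ x) → toℕ (opposite x) ∈ₛ shapeBelow a) ×
                                  (toℕ (opposite x) ∈ₛ shapeBelow a → inj₂ a ≼ inj₂ (inj₁ x))
    left-leaf (inj₁ x₀) = suffix⇔opposite-prefix x (<⇒≤ (toℕ<n x₀))
    left-leaf (inj₂ y₀) = (λ ()) , λ k≤ → <⇒≱ (toℕ<n (opposite x)) (≤-trans (m≤m+n k (toℕ y₀)) k≤)
  ... | right y rewrite parent-↑ʳ y | position-↑ʳ y | toℕ-↑ʳ k y = right-leaf a
    where
    right-leaf : (a : ArmVertex) → (inj₂ a ≼ inj₂ (inj₂ y) → k + toℕ y ∈ₛ shapeBelow a) ×
                                   (k + toℕ y ∈ₛ shapeBelow a → inj₂ a ≼ inj₂ (inj₂ y))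
    right-leaf (inj₁ x₀) = (λ ()) , λ <k-x₀ → <⇒≱ <k-x₀ (≤-trans (m∸n≤m k (toℕ x₀)) (m≤m+n k (toℕ y)))
    right-leaf (inj₂ y₀) = +-monoʳ-≤ k , +-cancelˡ-≤ k _ _

  shapeOf-valid : (e : Edge) → ValidShape k (shapeOf e)
  shapeOf-valid e with lowerEnd e
  ... | inj₁ x₀ = m<n⇒0<n∸m (toℕ<n x₀) , m∸n≤m k (toℕ x₀)
  ... | inj₂ y₀ = m≤m+n k (toℕ y₀) , +-monoʳ-< k (toℕ<n y₀)

  shapeOf-surjective : (S : Shape) → ValidShape k S → ∃ λ e → shapeOf e ≡ S
  shapeOf-surjective (prefix s) (1≤s , s≤k) = edgeAbove (inj₁ x₀) , (begin
    shapeBelow (lowerEnd (edgeAbove (inj₁ x₀))) ≡⟨ cong shapeBelow (lowerEnd-edgeAbove (inj₁ x₀)) ⟩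
    prefix (k ∸ toℕ x₀)                         ≡⟨ cong (λ z → prefix (k ∸ z)) (toℕ-fromℕ< k-s<k) ⟩
    prefix (k ∸ (k ∸ s))                        ≡⟨ cong prefix (m∸[m∸n]≡n s≤k) ⟩
    prefix s                                    ∎)
    where
    k-s<k : k ∸ s < k
    k-s<k = ∸-monoʳ-< 1≤s s≤k
    x₀ : Fin k
    x₀ = fromℕ< k-s<k
  shapeOf-surjective (suffix r) (k≤r , r<k+k) = edgeAbove (inj₂ y₀) , (begin
    shapeBelow (lowerEnd (edgeAbove (inj₂ y₀))) ≡⟨ cong shapeBelow (lowerEnd-edgeAbove (inj₂ y₀)) ⟩
    suffix (k + toℕ y₀)                         ≡⟨ cong (λ z → suffix (k + z)) (toℕ-fromℕ< r-k<k) ⟩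
    suffix (k + (r ∸ k))                        ≡⟨ cong suffix (m+[n∸m]≡n k≤r) ⟩
    suffix r                                    ∎)
    where
    r-k<k : r ∸ k < k
    r-k<k = +-cancelˡ-< k _ _ (subst (_< k + k) (sym (m+[n∸m]≡n k≤r)) r<k+k)
    y₀ : Fin k
    y₀ = fromℕ< r-k<k

  TailsMatch : (Fin (k + k) → Fin (k + k)) → Edge → Edge → Set
  TailsMatch f e₁ e₂ = (u : Fin (k + k)) → (Below e₁ (parent t u) → Below e₂ (parent t (f u))) ×
                                            (Below e₂ (parent t (f u)) → Below e₁ (parent t u))

  MatchedCut : (Fin (k + k) → Fin (k + k)) → Set
  MatchedCut f = Σ Edge λ e₁ → Σ Edge λ e₂ → TailsMatch f e₁ e₂

  conjugate : Vec (Fin (k + k)) (k + k) → Vec (Fin (k + k)) (k + k)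
  conjugate σ = tabulate λ q → position (lookup σ (position q))

  lookup-conjugate : (σ : Vec (Fin (k + k)) (k + k)) (u : Fin (k + k)) →
    lookup (conjugate σ) (position u) ≡ position (lookup σ u)
  lookup-conjugate σ u = trans (lookup∘tabulate (λ q → position (lookup σ (position q))) (position u)) (cong (λ z → position (lookup σ z)) (position-involutive u))

  conjugate-involutive : (σ : Vec (Fin (k + k)) (k + k)) → conjugate (conjugate σ) ≡ σ
  conjugate-involutive σ = lookup-extensionality _ σ λ q → begin
    lookup (conjugate (conjugate σ)) q          ≡⟨ lookup∘tabulate (λ q → position (lookup (conjugate σ) (position q))) q ⟩
    position (lookup (conjugate σ) (position q)) ≡⟨ cong position (lookup-conjugate σ q) ⟩
    position (position (lookup σ q))            ≡⟨ position-involutive _ ⟩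
    lookup σ q                                  ∎

  conjugate-perm : {σ : Vec (Fin (k + k)) (k + k)} → IsPerm (k + k) σ → IsPerm (k + k) (conjugate σ)
  conjugate-perm {σ} (injective , surjective) =
    (λ q q′ eq → position-injective (injective _ _ (position-injective
      (trans (sym (lookup∘tabulate conjugated q)) (trans eq (lookup∘tabulate conjugated q′)))))) ,
    (λ y → let (u , eq) = surjective (position y) in
           position u , trans (lookup-conjugate σ u) (trans (cong position eq) (position-involutive y)))
    where
    conjugated : Fin (k + k) → Fin (k + k)
    conjugated q = position (lookup σ (position q))
    position-injective : ∀ {u v} → position u ≡ position v → u ≡ v
    position-injective {u} {v} eq = trans (sym (position-involutive u)) (trans (cong position eq) (position-involutive v))

  module _ (σ : Vec (Fin (k + k)) (k + k)) (e₁ e₂ : Edge) where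

    TailsMatch⇒Matches : TailsMatch (lookup σ) e₁ e₂ → Matches (shapeOf e₁) (shapeOf e₂) (lookup (conjugate σ))
    TailsMatch⇒Matches tails q = subst (λ q → (toℕ q ∈ₛ shapeOf e₁ → toℕ (lookup (conjugate σ) q) ∈ₛ shapeOf e₂) ×
                                              (toℕ (lookup (conjugate σ) q) ∈ₛ shapeOf e₂ → toℕ q ∈ₛ shapeOf e₁))
      (position-involutive q) (at (position q))
      where
      at : ∀ u → (toℕ (position u) ∈ₛ shapeOf e₁ → toℕ (lookup (conjugate σ) (position u)) ∈ₛ shapeOf e₂) ×
                 (toℕ (lookup (conjugate σ) (position u)) ∈ₛ shapeOf e₂ → toℕ (position u) ∈ₛ shapeOf e₁)
      at u rewrite lookup-conjugate σ u =
        (λ u∈ → proj₁ (≼-parent⇔position∈ₛ (lowerEnd e₂) (lookup σ u)) (proj₁ (tails u) (proj₂ (≼-parent⇔position∈ₛ (lowerEnd e₁) u) u∈))) ,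
        (λ σu∈ → proj₁ (≼-parent⇔position∈ₛ (lowerEnd e₁) u) (proj₂ (tails u) (proj₂ (≼-parent⇔position∈ₛ (lowerEnd e₂) (lookup σ u)) σu∈)))

    Matches⇒TailsMatch : Matches (shapeOf e₁) (shapeOf e₂) (lookup (conjugate σ)) → TailsMatch (lookup σ) e₁ e₂
    Matches⇒TailsMatch matches u =
      (λ below₁ → proj₂ (≼-parent⇔position∈ₛ (lowerEnd e₂) (lookup σ u)) (subst (λ z → toℕ z ∈ₛ shapeOf e₂) (lookup-conjugate σ u)
        (proj₁ (matches (position u)) (proj₁ (≼-parent⇔position∈ₛ (lowerEnd e₁) u) below₁)))) ,
      (λ below₂ → proj₂ (≼-parent⇔position∈ₛ (lowerEnd e₁) u) (proj₂ (matches (position u))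
        (subst (λ z → toℕ z ∈ₛ shapeOf e₂) (sym (lookup-conjugate σ u)) (proj₁ (≼-parent⇔position∈ₛ (lowerEnd e₂) (lookup σ u)) below₂))))

  MatchedCut⇒ShapeMatched : (σ : Vec (Fin (k + k)) (k + k)) → MatchedCut (lookup σ) → ShapeMatched k (conjugate σ)
  MatchedCut⇒ShapeMatched σ (e₁ , e₂ , tails) =
    shapeOf e₁ , shapeOf e₂ , shapeOf-valid e₁ , shapeOf-valid e₂ , TailsMatch⇒Matches σ e₁ e₂ tails

  ShapeMatched⇒MatchedCut : (σ : Vec (Fin (k + k)) (k + k)) → ShapeMatched k (conjugate σ) → MatchedCut (lookup σ)
  ShapeMatched⇒MatchedCut σ (S₁ , S₂ , valid₁ , valid₂ , matches) with shapeOf-surjective S₁ valid₁ | shapeOf-surjective S₂ valid₂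
  ... | e₁ , refl | e₂ , refl = e₁ , e₂ , Matches⇒TailsMatch σ e₁ e₂ matches

  armᵥ : Bool → Fin k → ArmVertex
  armᵥ true = inj₁
  armᵥ false = inj₂

  spine : Bool → Fin n → Edge
  spine true p = inj₂ (inj₁ p)
  spine false p = inj₂ (inj₂ p)

  spine≢root : (b b′ : Bool) (p : Fin n) → spine b p ≢ inj₁ b′
  spine≢root true _ _ ()
  spine≢root false _ _ ()

  ends-root : (b : Bool) → ends t (inj₁ b) ≡ (inj₁ tt , inj₂ (armᵥ b zero))
  ends-root true = refl
  ends-root false = refl

  ends-spine : (b : Bool) (p : Fin n) → ends t (spine b p) ≡ (inj₂ (armᵥ b (inject₁ p)) , inj₂ (armᵥ b (suc p)))
  ends-spine true p = refl
  ends-spine false p = refl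

  Below-root-edge : (b : Bool) (x : Fin k) → Below (inj₁ b) (inj₂ (armᵥ b x))
  Below-root-edge true x = z≤n
  Below-root-edge false x = z≤n

  Below-spine : (b : Bool) (p : Fin n) (x : Fin k) → toℕ p < toℕ x → Below (spine b p) (inj₂ (armᵥ b x))
  Below-spine true p x p<x = p<x
  Below-spine false p x p<x = p<x

  ≼-refl : (a : ArmVertex) → inj₂ a ≼ inj₂ a
  ≼-refl (inj₁ x) = ≤-refl
  ≼-refl (inj₂ y) = ≤-refl

  leafAt : (a : ArmVertex) → ∃ λ u → parent t u ≡ inj₂ a
  leafAt (inj₁ x) = x ↑ˡ k , parent-↑ˡ x
  leafAt (inj₂ y) = k ↑ʳ y , parent-↑ʳ y

  leafOutside : (a : ArmVertex) → ∃ λ u → ¬ inj₂ a ≼ parent t u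
  leafOutside (inj₁ x) = k ↑ʳ zero , subst (λ w → ¬ inj₂ (inj₁ x) ≼ w) (sym (parent-↑ʳ zero)) λ ()
  leafOutside (inj₂ y) = zero ↑ˡ k , subst (λ w → ¬ inj₂ (inj₂ y) ≼ w) (sym (parent-↑ˡ zero)) λ ()

module _ {t₁ t₂ : RTree} {σ : Fin (leaves t₁) → Fin (leaves t₂)} {ok : Gluing.E t₁ t₂ σ → Set} where
  open Gluing t₁ t₂ σ

  Conn-trans : ∀ {a b c} → Conn ok a b → Conn ok b c → Conn ok a c
  Conn-trans here q = q
  Conn-trans (step e ok-e ends p) q = step e ok-e ends (Conn-trans p q)

  Conn-sym : ∀ {a b} → Conn ok a b → Conn ok b a
  Conn-sym here = here
  Conn-sym (step e ok-e ends p) = Conn-trans (Conn-sym p) (step e ok-e (Data.Sum.swap ends) here)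

  Conn-edge : ∀ {a b} (e : E) → ok e → endpoints e ≡ (a , b) → Conn ok a b
  Conn-edge e ok-e ends = step e ok-e (inj₁ ends) here

  Conn-invariant : (S : V → Set) →
    (∀ e → ok e → (S (proj₁ (endpoints e)) → S (proj₂ (endpoints e))) × (S (proj₂ (endpoints e)) → S (proj₁ (endpoints e)))) →
    ∀ {a b} → Conn ok a b → S a → S b
  Conn-invariant S closed here sa = sa
  Conn-invariant S closed (step e ok-e (inj₁ ends) p) sa = Conn-invariant S closed p
    (subst (S ∘ proj₂) ends (proj₁ (closed e ok-e) (subst (S ∘ proj₁) (sym ends) sa)))
  Conn-invariant S closed (step e ok-e (inj₂ ends) p) sa = Conn-invariant S closed p
    (subst (S ∘ proj₁) ends (proj₂ (closed e ok-e) (subst (S ∘ proj₂) (sym ends) sa)))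

module Glued (n : ℕ) (σ : Fin (suc n + suc n) → Fin (suc n + suc n)) where
  open DoubleArm n
  open Gluing t t σ

  data Copy : Set where
    first second : Copy

  inCopy : Copy → Vertex → V
  inCopy first = inj₁
  inCopy second = inj₂

  edgeIn : Copy → Edge → E
  edgeIn first = inj₁
  edgeIn second = inj₂ ∘ inj₁

  endpoints-edgeIn : (s : Copy) (x : Edge) → endpoints (edgeIn s x) ≡ (inCopy s (proj₁ (ends t x)) , inCopy s (proj₂ (ends t x)))
  endpoints-edgeIn first (inj₁ true) = refl
  endpoints-edgeIn first (inj₁ false) = refl
  endpoints-edgeIn first (inj₂ (inj₁ _)) = refl
  endpoints-edgeIn first (inj₂ (inj₂ _)) = refl
  endpoints-edgeIn second (inj₁ true) = refl
  endpoints-edgeIn second (inj₁ false) = refl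
  endpoints-edgeIn second (inj₂ (inj₁ _)) = refl
  endpoints-edgeIn second (inj₂ (inj₂ _)) = refl

  module Cut (e₁ e₂ : Edge) where

    ok : E → Set
    ok e = (e ≢ inj₁ e₁) × (e ≢ inj₂ (inj₁ e₂))

    removed : Copy → Edge
    removed first = e₁
    removed second = e₂

    ok-edgeIn : (s : Copy) (x : Edge) → x ≢ removed s → ok (edgeIn s x)
    ok-edgeIn first x x≢e₁ = (λ { refl → x≢e₁ refl }) , (λ ())
    ok-edgeIn second x x≢e₂ = (λ ()) , (λ { refl → x≢e₂ refl })

    leaf-conn : (u : Fin (k + k)) → Conn ok (inj₁ (parent t u)) (inj₂ (parent t (σ u)))
    leaf-conn u = Conn-edge (inj₂ (inj₂ u)) ((λ ()) , (λ ())) refl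

    tree-edge-conn : (s : Copy) (x : Edge) → x ≢ removed s → ∀ {a b} → ends t x ≡ (a , b) → Conn ok (inCopy s a) (inCopy s b)
    tree-edge-conn s x x≢ ends-x = Conn-edge (edgeIn s x) (ok-edgeIn s x x≢)
      (trans (endpoints-edgeIn s x) (cong (λ (a , b) → inCopy s a , inCopy s b) ends-x))

    arm-path : (s : Copy) (b : Bool) (d : ℕ) (a x : Fin k) → toℕ x ≡ d → toℕ a ≤ d →
      (∀ q → toℕ a ≤ toℕ q → toℕ q < d → spine b q ≢ removed s) →
      Conn ok (inCopy s (inj₂ (armᵥ b a))) (inCopy s (inj₂ (armᵥ b x)))
    arm-path s b zero zero zero _ _ _ = here
    arm-path s b zero (suc a) x _ () _
    arm-path s b zero zero (suc x) () _ _
    arm-path s b (suc d) a x x≡d a≤d usable with m≤n⇒m<n∨m≡n a≤d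
    ... | inj₂ a≡d = subst (λ z → Conn ok (inCopy s (inj₂ (armᵥ b a))) (inCopy s (inj₂ (armᵥ b z)))) (toℕ-injective (trans a≡d (sym x≡d))) here
    arm-path s b (suc d) a zero () a≤d usable | inj₁ _
    arm-path s b (suc d) a (suc x) x≡d a≤d usable | inj₁ (s≤s a≤x) =
      Conn-trans (arm-path s b d a (inject₁ x) (trans (toℕ-inject₁ x) x≡d′) a≤x (λ q a≤q q<d → usable q a≤q (m≤n⇒m≤1+n q<d)))
                 (tree-edge-conn s (spine b x) (usable x (subst (toℕ a ≤_) (sym x≡d′) a≤x) (subst (_< suc d) (sym x≡d′) ≤-refl))
                   (ends-spine b x))
      where
      x≡d′ : toℕ x ≡ d
      x≡d′ = suc-injective x≡d

    root-conn-arm : (s : Copy) (b : Bool) (x : Fin k) → ¬ Below (removed s) (inj₂ (armᵥ b x)) →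
      Conn ok (inCopy s (inj₁ tt)) (inCopy s (inj₂ (armᵥ b x)))
    root-conn-arm s b x not-below = Conn-trans
      (tree-edge-conn s (inj₁ b) (λ eq → not-below (subst (λ e → Below e (inj₂ (armᵥ b x))) eq (Below-root-edge b x))) (ends-root b))
      (arm-path s b (toℕ x) zero x refl z≤n λ q _ q<x eq → not-below (subst (λ e → Below e (inj₂ (armᵥ b x))) eq (Below-spine b q x q<x)))

    root-conn : (s : Copy) (w : Vertex) → ¬ Below (removed s) w → Conn ok (inCopy s (inj₁ tt)) (inCopy s w)
    root-conn s (inj₁ tt) _ = here
    root-conn s (inj₂ (inj₁ x)) = root-conn-arm s true x
    root-conn s (inj₂ (inj₂ y)) = root-conn-arm s false y

    tail-conn : (s : Copy) (e : Edge) → removed s ≡ e → (w : Vertex) → Below e w →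
      Conn ok (inCopy s (inj₂ (lowerEnd e))) (inCopy s w)
    tail-conn s e _ (inj₁ tt) below = ⊥-elim (root-not-Below e below)
    tail-conn s (inj₁ true) removed≡ (inj₂ (inj₁ x)) _ = arm-path s true (toℕ x) zero x refl z≤n
      λ q _ _ eq → spine≢root true true q (trans eq removed≡)
    tail-conn s (inj₁ false) removed≡ (inj₂ (inj₂ y)) _ = arm-path s false (toℕ y) zero y refl z≤n
      λ q _ _ eq → spine≢root false false q (trans eq removed≡)
    tail-conn s (inj₂ (inj₁ p)) removed≡ (inj₂ (inj₁ x)) p<x = arm-path s true (toℕ x) (suc p) x refl p<x
      λ q p<q _ eq → <-irrefl (cong (λ { (inj₂ (inj₁ r)) → toℕ r ; _ → 0 }) (sym (trans eq removed≡))) p<q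
    tail-conn s (inj₂ (inj₂ p)) removed≡ (inj₂ (inj₂ y)) p<y = arm-path s false (toℕ y) (suc p) y refl p<y
      λ q p<q _ eq → <-irrefl (cong (λ { (inj₂ (inj₂ r)) → toℕ r ; _ → 0 }) (sym (trans eq removed≡))) p<q
    tail-conn s (inj₁ true) _ (inj₂ (inj₂ _)) ()
    tail-conn s (inj₁ false) _ (inj₂ (inj₁ _)) ()
    tail-conn s (inj₂ (inj₁ _)) _ (inj₂ (inj₂ _)) ()
    tail-conn s (inj₂ (inj₂ _)) _ (inj₂ (inj₁ _)) ()

    InTail : V → Set
    InTail (inj₁ w) = Below e₁ w
    InTail (inj₂ w) = Below e₂ w

    InTail-closed : TailsMatch σ e₁ e₂ → ∀ e → ok e →
      (InTail (proj₁ (endpoints e)) → InTail (proj₂ (endpoints e))) × (InTail (proj₂ (endpoints e)) → InTail (proj₁ (endpoints e)))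
    InTail-closed _ (inj₁ x) (x≢e₁ , _) =
      subst (λ (a , b) → (InTail a → InTail b) × (InTail b → InTail a)) (sym (endpoints-edgeIn first x))
        (Below-ends e₁ x (x≢e₁ ∘ cong inj₁))
    InTail-closed _ (inj₂ (inj₁ x)) (_ , x≢e₂) =
      subst (λ (a , b) → (InTail a → InTail b) × (InTail b → InTail a)) (sym (endpoints-edgeIn second x))
        (Below-ends e₂ x (x≢e₂ ∘ cong (inj₂ ∘ inj₁)))
    InTail-closed tails (inj₂ (inj₂ u)) _ = tails u

    copy-connected : (s : Copy) → Conn ok r₁ (inCopy s (inj₁ tt)) → Conn ok r₁ (inCopy s (inj₂ (lowerEnd (removed s)))) →
      (w : Vertex) → Conn ok r₁ (inCopy s w)
    copy-connected s to-root to-tail w with Below? (removed s) w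
    ... | yes below = Conn-trans to-tail (tail-conn s (removed s) refl w below)
    ... | no not-below = Conn-trans to-root (root-conn s w not-below)

    connected-via-tail₁ : (∀ y → ∃ λ x → σ x ≡ y) → Conn ok r₁ r₂ → Conn ok r₁ (inj₁ (inj₂ (lowerEnd e₁))) → (w : V) → Conn ok r₁ w
    connected-via-tail₁ surjective r₁~r₂ r₁~tail₁ (inj₁ w) = copy-connected first here r₁~tail₁ w
    connected-via-tail₁ surjective r₁~r₂ r₁~tail₁ (inj₂ w) = copy-connected second r₁~r₂ r₁~tail₂ w
      where
      l₂ u : Fin (k + k)
      l₂ = proj₁ (leafAt (lowerEnd e₂))
      u = proj₁ (surjective l₂)
      r₁~tail₂ : Conn ok r₁ (inj₂ (inj₂ (lowerEnd e₂)))
      r₁~tail₂ = subst (λ z → Conn ok r₁ (inj₂ z)) (trans (cong (parent t) (proj₂ (surjective l₂))) (proj₂ (leafAt (lowerEnd e₂))))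
        (Conn-trans (copy-connected first here r₁~tail₁ (parent t u)) (leaf-conn u))

    connected-via-tail₂ : Conn ok r₁ r₂ → Conn ok r₁ (inj₂ (inj₂ (lowerEnd e₂))) → (w : V) → Conn ok r₁ w
    connected-via-tail₂ r₁~r₂ r₁~tail₂ (inj₂ w) = copy-connected second r₁~r₂ r₁~tail₂ w
    connected-via-tail₂ r₁~r₂ r₁~tail₂ (inj₁ w) = copy-connected first here r₁~tail₁ w
      where
      l₁ : Fin (k + k)
      l₁ = proj₁ (leafAt (lowerEnd e₁))
      r₁~tail₁ : Conn ok r₁ (inj₁ (inj₂ (lowerEnd e₁)))
      r₁~tail₁ = subst (λ z → Conn ok r₁ (inj₁ z)) (proj₂ (leafAt (lowerEnd e₁)))
        (Conn-trans (copy-connected second r₁~r₂ r₁~tail₂ (parent t (σ l₁))) (Conn-sym (leaf-conn l₁)))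

  MatchedCut⇒Subdivergence : MatchedCut σ → Subdivergence
  MatchedCut⇒Subdivergence (e₁ , e₂ , tails) =
    e₁ , e₂ , tail₁ , r₁~r₂ , tail-unreachable r₁ (root-not-Below e₁) , tail-unreachable r₂ (root-not-Below e₂) , reachable
    where
    open Cut e₁ e₂
    tail₁ : V
    tail₁ = inj₁ (inj₂ (lowerEnd e₁))
    tail-unreachable : (r : V) → ¬ InTail r → ¬ Conn ok r tail₁
    tail-unreachable r r∉ r~tail₁ = r∉ (Conn-invariant InTail (InTail-closed tails) (Conn-sym r~tail₁) (≼-refl (lowerEnd e₁)))
    r₁~r₂ : Conn ok r₁ r₂
    r₁~r₂ with leafOutside (lowerEnd e₁)
    ... | u , outside = Conn-trans (root-conn first (parent t u) outside)
          (Conn-trans (leaf-conn u) (Conn-sym (root-conn second (parent t (σ u)) (outside ∘ proj₂ (tails u)))))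
    reachable : (w : V) → Conn ok r₁ w ⊎ Conn ok tail₁ w
    reachable (inj₁ w) with Below? e₁ w
    ... | yes below = inj₂ (tail-conn first e₁ refl w below)
    ... | no not-below = inj₁ (root-conn first w not-below)
    reachable (inj₂ w) with Below? e₂ w
    ... | no not-below = inj₁ (Conn-trans r₁~r₂ (root-conn second w not-below))
    ... | yes below with leafAt (lowerEnd e₁)
    ...   | l₁ , parent≡ = inj₂ (Conn-trans tail₁~σl₁ (tail-conn second e₂ refl w below))
      where
      tail₁~σl₁ : Conn ok tail₁ (inj₂ (inj₂ (lowerEnd e₂)))
      tail₁~σl₁ = Conn-trans (subst (λ z → Conn ok (inj₁ z) (inj₂ (parent t (σ l₁)))) parent≡ (leaf-conn l₁))
        (Conn-sym (tail-conn second e₂ refl (parent t (σ l₁)) (proj₁ (tails l₁) (subst (Below e₁) (sym parent≡) (≼-refl (lowerEnd e₁))))))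

  Subdivergence⇒MatchedCut : IsBij σ → Subdivergence → MatchedCut σ
  Subdivergence⇒MatchedCut (_ , surjective) (e₁ , e₂ , v , r₁~r₂ , r₁≁v , _ , _) = e₁ , e₂ , tails
    where
    open Cut e₁ e₂
    tails : TailsMatch σ e₁ e₂
    tails u with Below? e₁ (parent t u) | Below? e₂ (parent t (σ u))
    ... | yes below₁ | yes below₂ = (λ _ → below₂) , (λ _ → below₁)
    ... | no not-below₁ | no not-below₂ = ⊥-elim ∘ not-below₁ , ⊥-elim ∘ not-below₂
    ... | yes below₁ | no not-below₂ = ⊥-elim (r₁≁v (connected-via-tail₁ surjective r₁~r₂
          (Conn-trans r₁~r₂ (Conn-trans (root-conn second (parent t (σ u)) not-below₂)
            (Conn-trans (Conn-sym (leaf-conn u)) (Conn-sym (tail-conn first e₁ refl (parent t u) below₁))))) v))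
    ... | no not-below₁ | yes below₂ = ⊥-elim (r₁≁v (connected-via-tail₂ r₁~r₂
          (Conn-trans (root-conn first (parent t u) not-below₁)
            (Conn-trans (leaf-conn u) (Conn-sym (tail-conn second e₂ refl (parent t (σ u)) below₂)))) v))

card-noSubdivergence : (n : ℕ) → NoSubdivCount (d₊ n n) (d₊ n n) (bothIndecomposables (suc n + suc n))
card-noSubdivergence n = card-cong conjugated-count ((λ {v} → to {v}) , λ {v} → from {v})
  where
  open DoubleArm n
  conjugated-count : Card (λ v → BothIndecomposable (k + k) (conjugate v)) (bothIndecomposables (k + k))
  conjugated-count = subst (Card _) (card-≡ (card-filter _) (card-filter (BothIndecomposable? (k + k)))
      (involution-injectionOn conjugate conjugate-involutive λ both → both)
      (involution-injectionOn conjugate conjugate-involutive λ {σ} both → subst (BothIndecomposable (k + k)) (sym (conjugate-involutive σ)) both))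
    (card-filter λ v → BothIndecomposable? (k + k) (conjugate v))
  to : ∀ {v} → BothIndecomposable (k + k) (conjugate v) → IsBij (lookup v) × ¬ Gluing.Subdivergence t t (lookup v)
  to {v} (perm , indecomposable , skew-indecomposable) = perm′ , λ subdivergence →
    [ indecomposable , skew-indecomposable ]′ (ShapeMatched⇒decomposable k (conjugate v) perm
      (MatchedCut⇒ShapeMatched v (Glued.Subdivergence⇒MatchedCut n (lookup v) perm′ subdivergence)))
    where
    perm′ : IsPerm (k + k) v
    perm′ = subst (IsPerm (k + k)) (conjugate-involutive v) (conjugate-perm {σ = conjugate v} perm)
  from : ∀ {v} → IsBij (lookup v) × ¬ Gluing.Subdivergence t t (lookup v) → BothIndecomposable (k + k) (conjugate v)
  from {v} (perm , no-subdivergence) = conjugate-perm {σ = v} perm ,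
    (λ decomposable → no-subdivergence (cut (inj₁ decomposable))) ,
    (λ skew → no-subdivergence (cut (inj₂ skew)))
    where
    cut : Decomposable (conjugate v) ⊎ Decomposable (complement (conjugate v)) → Gluing.Subdivergence t t (lookup v)
    cut = Glued.MatchedCut⇒Subdivergence n (lookup v) ∘ ShapeMatched⇒MatchedCut v ∘ decomposable⇒ShapeMatched k (conjugate v)

mainTheorem4 : (n : ℕ) →
    Σ ℕ λ N → NoSubdivCount (d₊ n n) (d₊ n n) N ×
      N + 2 * (suc n ! * suc n !
         + sum1to n (λ i → sum1to n (λ j → i ! * j ! * c (2 * suc n ∸ i ∸ j)))
         + 2 * sum1to n (λ i → i ! * c (2 * suc n ∸ i)))
      ≡ (2 * suc n) !
mainTheorem4 n = bothIndecomposables K , card-noSubdivergence n , subst (λ M → bothIndecomposables K + 2 * X M ≡ M !) K≡2k count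
  where
  K : ℕ
  K = suc n + suc n
  X : ℕ → ℕ
  X M = suc n ! * suc n ! + sum1to n (λ i → sum1to n (λ j → i ! * j ! * c (M ∸ i ∸ j))) + 2 * sum1to n (λ i → i ! * c (M ∸ i))
  K≡2k : K ≡ 2 * suc n
  K≡2k = cong (suc n +_) (sym (+-identityʳ (suc n)))
  X≡decomposables : X K ≡ decomposables K
  X≡decomposables = +-cancelʳ-≡ (c K) _ _ (trans (square-identity-sum1to c factorial-recurrence n)
    (trans (sym (c+decomposables≡! K)) (+-comm (c K) (decomposables K))))
  count : bothIndecomposables K + 2 * X K ≡ K !
  count = trans (cong (λ x → bothIndecomposables K + 2 * x) X≡decomposables) (bothIndecomposables+2*decomposables≡! K)
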